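{- Let $q$ be a prime power, let $a$ and $b$ be relatively prime positive integers, and let $M = \{a i + b j : i,j \in \mathbb{N}\}$. For $n \geq 0$, the number $\alpha_q(n)$ of monic polynomials in $F_q[x]$ of degree $n$ such that the multiplicity of each irreducible factor belongs to $M$ is $$\alpha_q(n) = \sum_{\substack{i,j\geq 0\\ a i + b j = n}} q^{i+j} - \sum_{\substack{i,j \geq 0\\ a i + b j = n - ab}} q^{i+j+1}.$$
   Context: $F_q$ is the finite field with $q$ elements; $\mathbb{N} = \{0,1,2,\ldots\}$. -}

module Defs where

open import Data.Nat as ℕ using (ℕ; zero; suc; _≟_)
open import Data.Fin using (Fin)
open import Data.Nat.ListAction using (sum)
open import Data.List using (List; []; _∷_; map; upTo; length; _++_; [_])
open import Data.List.Relation.Unary.Unique.Propositional using (Unique)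
open import Data.List.Membership.Propositional using (_∈_)
open import Data.Vec using (Vec; toList)
open import Data.Product using (Σ; ∃; ∃-syntax; _×_; _,_)
open import Data.Sum using (_⊎_)
open import Data.Bool using (if_then_else_)
open import Relation.Nullary using (¬_)
open import Relation.Nullary.Decidable using (⌊_⌋)
open import Relation.Binary.PropositionalEquality using (_≡_)
open import Algebra.Structures using (IsCommutativeRing)
open import Function.Bundles using (_↔_; _⇔_)

record FiniteField (q : ℕ) : Set₁ where
  infixl 6 _+_
  infixl 7 _*_
  field
    Carrier : Set
    _+_ _*_ : Carrier → Carrier → Carrier
    -_ : Carrier → Carrier
    0# 1# : Carrier
    isCommutativeRing : IsCommutativeRing _≡_ _+_ _*_ -_ 0# 1#
    0≢1 : ¬ (0# ≡ 1#)
    inverse : ∀ x → ¬ (x ≡ 0#) → ∃[ y ] (x * y ≡ 1#)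
    card : Carrier ↔ Fin q

IsPrimePower : ℕ → Set
IsPrimePower q = ∃[ p ] ∃[ k ] (Data.Nat.Primality.Prime p × 1 ℕ.≤ k × q ≡ p ℕ.^ k)
  where import Data.Nat.Primality

module Poly {q : ℕ} (F : FiniteField q) where
  open FiniteField F

  -- polynomials as coefficient lists, lowest degree first
  Pol : Set
  Pol = List Carrier

  _+ₚ_ : Pol → Pol → Pol
  [] +ₚ g = g
  (a ∷ f) +ₚ [] = a ∷ f
  (a ∷ f) +ₚ (b ∷ g) = (a + b) ∷ (f +ₚ g)

  _*ₚ_ : Pol → Pol → Pol
  [] *ₚ g = []
  (a ∷ f) *ₚ g = map (a *_) g +ₚ (0# ∷ (f *ₚ g))

  -- a monic polynomial of degree d is given by its d lower coefficients
  Monic : ℕ → Set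
  Monic d = Vec Carrier d

  toPol : ∀ {d} → Monic d → Pol
  toPol v = toList v ++ [ 1# ]

  _^ₚ_ : Pol → ℕ → Pol
  f ^ₚ zero = [ 1# ]
  f ^ₚ suc k = f *ₚ (f ^ₚ k)

  _∣ₚ_ : Pol → Pol → Set
  g ∣ₚ f = ∃[ e ] Σ (Monic e) λ h → g *ₚ toPol h ≡ f

  Irreducible : ∀ {d} → Monic d → Set
  Irreducible {d} p = 1 ℕ.≤ d ×
    (∀ d₁ d₂ (u : Monic d₁) (w : Monic d₂) →
       toPol u *ₚ toPol w ≡ toPol p → d₁ ≡ 0 ⊎ d₂ ≡ 0)

  Multiplicity : ∀ {d n} → Monic d → Monic n → ℕ → Set
  Multiplicity p f m =
    ((toPol p ^ₚ m) ∣ₚ toPol f) × ¬ ((toPol p ^ₚ suc m) ∣ₚ toPol f)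

InM : ℕ → ℕ → ℕ → Set
InM a b m = ∃[ i ] ∃[ j ] (a ℕ.* i ℕ.+ b ℕ.* j ≡ m)

module _ {q : ℕ} (F : FiniteField q) where
  open Poly F

  Good : ℕ → ℕ → ∀ {n} → Monic n → Set
  Good a b f = ∀ d (p : Monic d) → Irreducible p → toPol p ∣ₚ toPol f →
    ∃[ m ] (Multiplicity p f m × InM a b m)

  IsCount : ℕ → ℕ → ℕ → ℕ → Set
  IsCount a b n α = ∃[ xs ] (Unique xs × length xs ≡ α ×
    (∀ (f : Monic n) → (f ∈ xs) ⇔ Good a b f))

-- Σ_{i,j ≥ 0, a i + b j + c = n} q^(i+j+e)
-- (i, j range over 0..n, which suffices since a, b ≥ 1)
S : ℕ → ℕ → ℕ → ℕ → ℕ → ℕ → ℕ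
S q a b c e n = sum (map (λ i → sum (map (λ j →
    if ⌊ a ℕ.* i ℕ.+ b ℕ.* j ℕ.+ c ≟ n ⌋ then q ℕ.^ (i ℕ.+ j ℕ.+ e) else 0)
    (upTo (suc n)))) (upTo (suc n)))

-- Since gcd(a, b) = 1, each m ∈ M is uniquely a i + b j with j < a. Reading off the multiplicities
-- of the irreducible factors, every monic f whose multiplicities all lie in M is therefore uniquely
-- g^a h^b with h a-th-power-free (all multiplicities below a), so
--   α(n) = Σ_{a i + b k = n} q^i A(k),
-- where A(k) counts the a-th-power-free monic polynomials of degree k. For b = 1 every monic
-- polynomial qualifies, and q^n = Σ_{a i + k = n} q^i A(k) gives A(k) = q^k - q^(k-a+1) for k ≥ a and
-- A(k) = q^k otherwise. Substituting, the correction terms, reindexed by k = a + j, form the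
-- subtracted sum.
--
-- Unique factorisation enters only through p-adic valuations, and Euclid's lemma for an irreducible p
-- is proved by descent on the degree of a cofactor instead of through gcds.

module Submission where

open import Defs
open import Data.Nat as ℕ using (ℕ; zero; suc; _≤_; _<_; z≤n; s≤s; _⊔_; _^_)
import Data.Nat.Properties as ℕ
open import Data.Nat.Induction using (<-rec)
open import Data.Nat.ListAction using (sum)
open import Data.Nat.Coprimality using (Coprime)
import Data.Nat.Coprimality as Coprime
open import Data.Bool using (if_then_else_)
open import Data.Fin.Properties using (inj⇒≟)
open import Data.Vec as Vec using (Vec)
import Data.Vec.Properties as Vec
open import Data.List using (List; []; _∷_; map; [_]; length; tabulate; cartesianProductWith; concatMap; upTo; applyUpTo; filter)
open import Data.List.Properties using (length-map; length-tabulate; length-++; map-cong)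
open import Data.List.Membership.Propositional using (_∈_; lose; find)
open import Data.List.Membership.Propositional.Properties
  using (∈-tabulate⁺; ∈-cartesianProductWith⁺; ∈-filter⁺; ∈-filter⁻; ∈-concatMap⁺; ∈-concatMap⁻; ∈-map⁺; ∈-map⁻; ∈-upTo⁺)
open import Data.List.Membership.Propositional.Properties.WithK using (unique∧set⇒bag)
open import Data.List.Relation.Binary.BagAndSetEquality using (∼bag⇒↭)
open import Data.List.Relation.Binary.Permutation.Propositional.Properties using (↭-length)
open import Data.List.Relation.Unary.Any as Any using (Any; here; there)
open import Data.List.Relation.Unary.All as All using (All)
import Data.List.Relation.Unary.All.Properties as All
open import Data.List.Relation.Unary.AllPairs as AllPairs using (AllPairs)
import Data.List.Relation.Unary.AllPairs.Properties as AllPairs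
open import Data.List.Relation.Unary.Unique.Propositional using (Unique)
import Data.List.Relation.Unary.Unique.Propositional.Properties as Unique
open import Data.Product using (Σ; _,_; _×_; proj₁; proj₂)
open import Data.Sum using (_⊎_; inj₁; inj₂)
open import Data.Empty using (⊥-elim)
open import Data.Maybe using (nothing)
open import Relation.Nullary using (¬_; Dec; yes; no; ¬?)
open import Relation.Nullary.Decidable using (⌊_⌋; _×-dec_)
open import Relation.Binary using (tri<; tri≈; tri>; DecidableEquality)
open import Relation.Binary.Bundles using (Setoid)
open import Relation.Binary.Structures using (IsEquivalence)
import Relation.Binary.Reasoning.Setoid as SetoidReasoning
open import Relation.Binary.PropositionalEquality hiding ([_])
open import Function.Bundles using (Inverse; _⇔_; mk⇔; Equivalence)
open import Function.Properties.Inverse using (↔⇒↣)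
open import Algebra.Bundles using (CommutativeRing)
open import Algebra.Structures using (IsCommutativeRing)
import Algebra.Properties.CommutativeSemigroup as CommutativeSemigroupProperties
import Algebra.Properties.CommutativeSemigroup.Divisibility as CommutativeSemigroupDivisibility
import Algebra.Properties.Monoid.Divisibility as MonoidDivisibility
import Algebra.Properties.Group as GroupProperties
import Algebra.Properties.AbelianGroup as AbelianGroupProperties
import Algebra.Properties.Ring as RingProperties
open import Tactic.RingSolver.Core.AlmostCommutativeRing using (fromCommutativeRing)
import Tactic.RingSolver.NonReflective as NonReflective

length-cartesianProductWith : ∀ {A B C : Set} (f : A → B → C) xs ys →
                              length (cartesianProductWith f xs ys) ≡ length xs ℕ.* length ys
length-cartesianProductWith f []       ys = refl
length-cartesianProductWith f (x ∷ xs) ys =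
  trans (length-++ (map (f x) ys)) (cong₂ ℕ._+_ (length-map (f x) ys) (length-cartesianProductWith f xs ys))

module _ {A B : Set} where

  length-concatMap : ∀ (f : A → List B) xs → length (concatMap f xs) ≡ sum (map (λ x → length (f x)) xs)
  length-concatMap f []       = refl
  length-concatMap f (x ∷ xs) = trans (length-++ (f x)) (cong (length (f x) ℕ.+_) (length-concatMap f xs))

  Unique-concatMap : ∀ (f : A → List B) {xs} → Unique xs → (∀ x → Unique (f x)) →
                     (∀ {x x′ y} → y ∈ f x → y ∈ f x′ → x ≡ x′) → Unique (concatMap f xs)
  Unique-concatMap f {xs} xs! f! disjoint = Unique.concat⁺ (All.map⁺ (All.universal f! xs))
    (AllPairs.map⁺ (AllPairs.map (λ x≢x′ {_} (y∈fx , y∈fx′) → x≢x′ (disjoint y∈fx y∈fx′)) xs!))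

  Unique-map-injectiveOn : ∀ (f : A → B) {xs} → Unique xs → (∀ {x y} → x ∈ xs → y ∈ xs → f x ≡ f y → x ≡ y) →
                           Unique (map f xs)
  Unique-map-injectiveOn f {[]}     _           _   = AllPairs.[]
  Unique-map-injectiveOn f {x ∷ xs} (x∉xs AllPairs.∷ xs!) inj =
    All.map⁺ (All.tabulate λ y∈xs fx≡fy → All.lookup x∉xs y∈xs (inj (here refl) (there y∈xs) fx≡fy))
    AllPairs.∷ Unique-map-injectiveOn f xs! (λ x∈ y∈ → inj (there x∈) (there y∈))

sum-map-const : ∀ {A : Set} (xs : List A) c → sum (map (λ _ → c) xs) ≡ length xs ℕ.* c
sum-map-const []       c = refl
sum-map-const (x ∷ xs) c = cong (c ℕ.+_) (sum-map-const xs c)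

module _ {P B : Set} {L : List B} where

  ∈-if⁻ : ∀ (P? : Dec P) {y} → y ∈ (if ⌊ P? ⌋ then L else []) → P × y ∈ L
  ∈-if⁻ (yes p) y∈L = p , y∈L

  ∈-if⁺ : ∀ (P? : Dec P) {y} → P → y ∈ L → y ∈ (if ⌊ P? ⌋ then L else [])
  ∈-if⁺ (yes _) _ y∈L = y∈L
  ∈-if⁺ (no ¬p) p _   = ⊥-elim (¬p p)

  Unique-if : ∀ (P? : Dec P) → (P → Unique L) → Unique (if ⌊ P? ⌋ then L else [])
  Unique-if (yes p) L! = L! p
  Unique-if (no _)  _  = AllPairs.[]

  length-if : ∀ (P? : Dec P) → length (if ⌊ P? ⌋ then L else []) ≡ (if ⌊ P? ⌋ then length L else 0)
  length-if (yes _) = refl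
  length-if (no _)  = refl

module NumericalSemigroup where
  open import Data.Nat using (_+_; _*_)
  open import Data.Nat.Divisibility using (_∣_; ∣m+n∣m⇒∣n; m∣m*n; ∣⇒≤)
  open import Data.Nat.DivMod using (_/_; _%_; m≡m%n+[m/n]*n; m%n<n)
  open import Data.Nat.Coprimality using (coprime-divisor)
  open import Data.Nat.Solver using (module +-*-Solver)

  InM-0 : ∀ a b → InM a b 0
  InM-0 a b = 0 , 0 , cong₂ _+_ (ℕ.*-zeroʳ a) (ℕ.*-zeroʳ b)

  InM-1 : ∀ a m → InM a 1 m
  InM-1 a m = 0 , m , cong₂ _+_ (ℕ.*-zeroʳ a) (ℕ.*-identityˡ m)

  InM-normalForm : ∀ {a b m} → 0 < a → InM a b m → Σ ℕ λ i → Σ ℕ λ j → a * i + b * j ≡ m × j < a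
  InM-normalForm {a@(suc _)} {b} {m} _ (i , j , ai+bj≡m) = i + b * (j / a) , j % a , eq , m%n<n j a
    where
      open +-*-Solver
      open ≡-Reasoning
      eq : a * (i + b * (j / a)) + b * (j % a) ≡ m
      eq = begin
        a * (i + b * (j / a)) + b * (j % a)
          ≡⟨ solve 5 (λ a i b q r → a :* (i :+ b :* q) :+ b :* r := a :* i :+ b :* (r :+ q :* a)) refl a i b (j / a) (j % a) ⟩
        a * i + b * (j % a + (j / a) * a)    ≡⟨ cong (λ t → a * i + b * t) (m≡m%n+[m/n]*n j a) ⟨
        a * i + b * j                        ≡⟨ ai+bj≡m ⟩
        m                                    ∎

  private
    shifted-normalForm : ∀ {a b x x′ y δ} → Coprime a b → δ < a →
                         a * x + b * y ≡ a * x′ + b * (y + δ) → δ ≡ 0 × x ≡ x′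
    shifted-normalForm {a@(suc _)} {b} {x} {x′} {y} {δ} coprime δ<a eq = δ≡0 , ℕ.*-cancelˡ-≡ x x′ a ax≡ax′
      where
        open +-*-Solver
        ax≡ax′+bδ : a * x ≡ a * x′ + b * δ
        ax≡ax′+bδ = ℕ.+-cancelʳ-≡ (b * y) (a * x) (a * x′ + b * δ)
          (trans eq (solve 5 (λ a x′ b y δ → a :* x′ :+ b :* (y :+ δ) := (a :* x′ :+ b :* δ) :+ b :* y) refl a x′ b y δ))
        a∣δ : a ∣ δ
        a∣δ = coprime-divisor coprime (∣m+n∣m⇒∣n (subst (a ∣_) ax≡ax′+bδ (m∣m*n x)) (m∣m*n x′))
        δ≡0 : δ ≡ 0
        δ≡0 with δ ℕ.≟ 0
        ... | yes δ≡0 = δ≡0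
        ... | no  δ≢0 = ⊥-elim (ℕ.<⇒≱ δ<a (∣⇒≤ {{ℕ.≢-nonZero δ≢0}} a∣δ))
        ax≡ax′ : a * x ≡ a * x′
        ax≡ax′ = trans ax≡ax′+bδ (trans (cong (λ t → a * x′ + b * t) δ≡0)
                                        (trans (cong (a * x′ +_) (ℕ.*-zeroʳ b)) (ℕ.+-identityʳ _)))

  normalForm-unique : ∀ {a b x y x′ y′} → Coprime a b → y < a → y′ < a →
                      a * x + b * y ≡ a * x′ + b * y′ → x ≡ x′ × y ≡ y′
  normalForm-unique {y = y} {y′ = y′} coprime y<a y′<a eq with ℕ.≤-total y y′
  ... | inj₁ y≤y′ with ℕ.m≤n⇒∃[o]m+o≡n y≤y′
  ...   | δ , refl with shifted-normalForm coprime (ℕ.≤-<-trans (ℕ.m≤n+m δ y) y′<a) eq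
  ...     | refl , x≡x′ = x≡x′ , sym (ℕ.+-identityʳ y)
  normalForm-unique {y = y} {y′ = y′} coprime y<a y′<a eq | inj₂ y′≤y with ℕ.m≤n⇒∃[o]m+o≡n y′≤y
  ...   | δ , refl with shifted-normalForm coprime (ℕ.≤-<-trans (ℕ.m≤n+m δ y′) y<a) (sym eq)
  ...     | refl , x′≡x = sym x′≡x , ℕ.+-identityʳ y′

open NumericalSemigroup

module Arithmetic where
  open import Data.Nat using (_+_; _*_; _∸_; _≟_; _≤?_; >-nonZero)
  open import Data.Nat.Properties
  open import Data.Nat.Solver using (module +-*-Solver)
  open +-*-Solver using (solve; _:+_; _:*_; _:=_; con)

  open +-*-Solver using (solve; _:+_; _:*_; _:=_; con)

  ∑< : ℕ → (ℕ → ℕ) → ℕ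
  ∑< zero    f = 0
  ∑< (suc N) f = f 0 + ∑< N (λ i → f (suc i))

  sum-applyUpTo : ∀ (f g : ℕ → ℕ) N → sum (map f (applyUpTo g N)) ≡ ∑< N (λ i → f (g i))
  sum-applyUpTo f g zero    = refl
  sum-applyUpTo f g (suc N) = cong (f (g 0) +_) (sum-applyUpTo f (λ i → g (suc i)) N)

  sum-upTo : ∀ N (f : ℕ → ℕ) → sum (map f (upTo N)) ≡ ∑< N f
  sum-upTo N f = sum-applyUpTo f (λ i → i) N

  ∑<-cong : ∀ N {f g : ℕ → ℕ} → (∀ i → i < N → f i ≡ g i) → ∑< N f ≡ ∑< N g
  ∑<-cong zero    _   = refl
  ∑<-cong (suc N) f≗g = cong₂ _+_ (f≗g 0 (s≤s z≤n)) (∑<-cong N λ i i<N → f≗g (suc i) (s≤s i<N))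

  ∑<-zero : ∀ N {f : ℕ → ℕ} → (∀ i → i < N → f i ≡ 0) → ∑< N f ≡ 0
  ∑<-zero zero    _   = refl
  ∑<-zero (suc N) f≗0 = cong₂ _+_ (f≗0 0 (s≤s z≤n)) (∑<-zero N λ i i<N → f≗0 (suc i) (s≤s i<N))

  ∑<-+ : ∀ N (f g : ℕ → ℕ) → ∑< N (λ i → f i + g i) ≡ ∑< N f + ∑< N g
  ∑<-+ zero    f g = refl
  ∑<-+ (suc N) f g = trans (cong (f 0 + g 0 +_) (∑<-+ N (λ i → f (suc i)) (λ i → g (suc i))))
                           (+-+-comm (f 0) (g 0) _ _)
    where open import Algebra.Properties.CommutativeSemigroup +-commutativeSemigroup using () renaming (interchange to +-+-comm)

  ∑<-*ˡ : ∀ N c (f : ℕ → ℕ) → ∑< N (λ i → c * f i) ≡ c * ∑< N f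
  ∑<-*ˡ zero    c f = sym (*-zeroʳ c)
  ∑<-*ˡ (suc N) c f = trans (cong (c * f 0 +_) (∑<-*ˡ N c (λ i → f (suc i)))) (sym (*-distribˡ-+ c (f 0) _))

  ∑<-split : ∀ M K (f : ℕ → ℕ) → ∑< (M + K) f ≡ ∑< M f + ∑< K (λ j → f (M + j))
  ∑<-split zero    K f = refl
  ∑<-split (suc M) K f = trans (cong (f 0 +_) (∑<-split M K (λ i → f (suc i)))) (sym (+-assoc (f 0) _ _))

  ∑<-truncate : ∀ {M N} (f : ℕ → ℕ) → M ≤ N → (∀ i → M ≤ i → i < N → f i ≡ 0) → ∑< N f ≡ ∑< M f
  ∑<-truncate {M} f M≤N f≗0 with m≤n⇒∃[o]m+o≡n M≤N
  ... | K , refl = trans (∑<-split M K f)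
    (trans (cong (∑< M f +_) (∑<-zero K λ j j<K → f≗0 (M + j) (m≤m+n M j) (+-monoʳ-< M j<K))) (+-identityʳ _))

  ∑<-shift : ∀ {M N} (f : ℕ → ℕ) → M ≤ N → (∀ i → i < M → f i ≡ 0) → ∑< N f ≡ ∑< (N ∸ M) (λ j → f (M + j))
  ∑<-shift {M} f M≤N f≗0 with m≤n⇒∃[o]m+o≡n M≤N
  ... | K , refl = trans (∑<-split M K f) (cong₂ _+_ (∑<-zero M f≗0) (cong (λ L → ∑< L _) (sym (m+n∸m≡n M K))))

  ∑<-single : ∀ N t (f : ℕ → ℕ) → t < N → (∀ i → i < N → i ≢ t → f i ≡ 0) → ∑< N f ≡ f t
  ∑<-single (suc N) zero    f _         f≗0 =
    trans (cong (f 0 +_) (∑<-zero N λ i i<N → f≗0 (suc i) (s≤s i<N) λ ())) (+-identityʳ (f 0))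
  ∑<-single (suc N) (suc t) f (s≤s t<N) f≗0 = trans (cong (_+ ∑< N (λ i → f (suc i))) (f≗0 0 (s≤s z≤n) λ ()))
    (∑<-single N t (λ i → f (suc i)) t<N λ i i<N i≢t → f≗0 (suc i) (s≤s i<N) (λ e → i≢t (suc-injective e)))

  sum-upTo² : ∀ N (f : ℕ → ℕ → ℕ) → sum (map (λ i → sum (map (f i) (upTo N))) (upTo N)) ≡ ∑< N (λ i → ∑< N (f i))
  sum-upTo² N f = trans (sum-upTo N _) (∑<-cong N λ i _ → sum-upTo N (f i))

  if-yes : ∀ {P : Set} (P? : Dec P) {x y : ℕ} → P → (if ⌊ P? ⌋ then x else y) ≡ x
  if-yes (yes _) _ = refl
  if-yes (no ¬p) p = ⊥-elim (¬p p)

  if-no : ∀ {P : Set} (P? : Dec P) {x y : ℕ} → ¬ P → (if ⌊ P? ⌋ then x else y) ≡ y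
  if-no (yes p) ¬p = ⊥-elim (¬p p)
  if-no (no _)  _  = refl

  -- Σ_{a i + c k = n} q^i A(k), with the summation ranges of Defs.S so that the two combine termwise.
  shapeSum : (q a c : ℕ) → (ℕ → ℕ) → ℕ → ℕ
  shapeSum q a c A n =
    sum (map (λ i → sum (map (λ k → if ⌊ a ℕ.* i ℕ.+ c ℕ.* k ℕ.≟ n ⌋ then q ^ i ℕ.* A k else 0)
                             (upTo (suc n))))
             (upTo (suc n)))

  module _ (q a : ℕ) (0<a : 0 < a) (A : ℕ → ℕ) (count : ∀ n → q ^ n ≡ shapeSum q a 1 A n) where

    private
      term : ℕ → ℕ → ℕ
      term i n = if ⌊ a * i ≤? n ⌋ then q ^ i * A (n ∸ a * i) else 0

      entry : ℕ → ℕ → ℕ → ℕ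
      entry n i k = if ⌊ a * i + 1 * k ≟ n ⌋ then q ^ i * A k else 0

      column : ∀ n i → ∑< (suc n) (entry n i) ≡ term i n
      column n i with a * i ≤? n
      ... | yes ai≤n = trans (∑<-single (suc n) (n ∸ a * i) (entry n i) (s≤s (m∸n≤m n (a * i))) off)
        (if-yes (a * i + 1 * (n ∸ a * i) ≟ n) (trans (cong (a * i +_) (*-identityˡ _)) (m+[n∸m]≡n ai≤n)))
        where
          off : ∀ k → k < suc n → k ≢ n ∸ a * i → entry n i k ≡ 0
          off k _ k≢ = if-no (a * i + 1 * k ≟ n) λ e →
            k≢ (trans (sym (*-identityˡ k)) (trans (sym (m+n∸m≡n (a * i) (1 * k))) (cong (_∸ a * i) e)))
      ... | no  ai≰n = ∑<-zero (suc n) λ k _ → if-no (a * i + 1 * k ≟ n) {q ^ i * A k} λ e →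
        ai≰n (subst (a * i ≤_) e (m≤m+n (a * i) (1 * k)))

      q^n≡∑term : ∀ n → q ^ n ≡ ∑< (suc n) (λ i → term i n)
      q^n≡∑term n = trans (count n) (trans (sum-upTo² (suc n) (entry n)) (∑<-cong (suc n) λ i _ → column n i))

      term-0 : ∀ n → term 0 n ≡ A n
      term-0 n = trans (if-yes (a * 0 ≤? n) (subst (_≤ n) (sym (*-zeroʳ a)) z≤n))
                       (trans (*-identityˡ _) (cong (λ m → A (n ∸ m)) (*-zeroʳ a)))

      term-suc : ∀ n i → a ≤ n → term (suc i) n ≡ q * term i (n ∸ a)
      term-suc n i a≤n with a * suc i ≤? n | a * i ≤? n ∸ a
      ... | yes _ | yes _ = trans (*-assoc q (q ^ i) _) (cong (λ m → q * (q ^ i * A m)) n∸a[1+i]≡n∸a∸ai)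
        where
          n∸a[1+i]≡n∸a∸ai : n ∸ a * suc i ≡ n ∸ a ∸ a * i
          n∸a[1+i]≡n∸a∸ai = trans (cong (n ∸_) (*-suc a i)) (sym (∸-+-assoc n a (a * i)))
      ... | yes a[1+i]≤n | no ai≰n∸a = ⊥-elim (ai≰n∸a
        (subst (_≤ n ∸ a) (m+n∸m≡n a (a * i)) (∸-monoˡ-≤ a (subst (_≤ n) (*-suc a i) a[1+i]≤n))))
      ... | no a[1+i]≰n | yes ai≤n∸a = ⊥-elim (a[1+i]≰n
        (subst (_≤ n) (sym (*-suc a i)) (subst (a + a * i ≤_) (m+[n∸m]≡n a≤n) (+-monoʳ-≤ a ai≤n∸a))))
      ... | no _ | no _ = sym (*-zeroʳ q)

      term-suc-small : ∀ n i → n < a → term (suc i) n ≡ 0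
      term-suc-small n i n<a = if-no (a * suc i ≤? n) λ a[1+i]≤n →
        <⇒≱ n<a (≤-trans (subst (a ≤_) (sym (*-suc a i)) (m≤m+n a (a * i))) a[1+i]≤n)

      term-large : ∀ n i → n < i → term i n ≡ 0
      term-large n i n<i = if-no (a * i ≤? n) λ ai≤n → <⇒≱ n<i (≤-trans (m≤n*m i a {{>-nonZero 0<a}}) ai≤n)

      higher-terms : ∀ n (a≤?n : Dec (a ≤ n)) →
                     ∑< n (λ i → term (suc i) n) ≡ (if ⌊ a≤?n ⌋ then q * q ^ (n ∸ a) else 0)
      higher-terms n (no a≰n)  = ∑<-zero n λ i _ → term-suc-small n i (≰⇒> a≰n)
      higher-terms n (yes a≤n) = begin
        ∑< n (λ i → term (suc i) n)                  ≡⟨ ∑<-cong n (λ i _ → term-suc n i a≤n) ⟩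
        ∑< n (λ i → q * term i (n ∸ a))              ≡⟨ ∑<-*ˡ n q _ ⟩
        q * ∑< n (λ i → term i (n ∸ a))              ≡⟨ cong (q *_) (∑<-truncate _ 1+n∸a≤n λ i 1+n∸a≤i _ →
                                                                       term-large (n ∸ a) i 1+n∸a≤i) ⟩
        q * ∑< (suc (n ∸ a)) (λ i → term i (n ∸ a))  ≡⟨ cong (q *_) (q^n≡∑term (n ∸ a)) ⟨
        q * q ^ (n ∸ a)                              ∎
        where
          open ≡-Reasoning
          1+n∸a≤n : suc (n ∸ a) ≤ n
          1+n∸a≤n = subst (_≤ n) (+-comm (n ∸ a) 1) (subst (n ∸ a + 1 ≤_) (m∸n+n≡m a≤n) (+-monoʳ-≤ (n ∸ a) 0<a))

    powerFreeCount-recurrence : ∀ n → A n + (if ⌊ a ≤? n ⌋ then q * q ^ (n ∸ a) else 0) ≡ q ^ n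
    powerFreeCount-recurrence n = sym (trans (q^n≡∑term n) (cong₂ _+_ (term-0 n) (higher-terms n (a ≤? n))))

  module _ (q a b : ℕ) (0<b : 0 < b) (A : ℕ → ℕ)
           (recurrence : ∀ k → A k + (if ⌊ a ≤? k ⌋ then q * q ^ (k ∸ a) else 0) ≡ q ^ k) (n : ℕ) where

    private
      good : ℕ → ℕ → ℕ
      good i k = if ⌊ a * i + b * k ≟ n ⌋ then q ^ i * A k else 0

      all : ℕ → ℕ → ℕ
      all i k = if ⌊ a * i + b * k + 0 ≟ n ⌋ then q ^ (i + k + 0) else 0

      shifted : ℕ → ℕ → ℕ
      shifted i j = if ⌊ a * i + b * j + a * b ≟ n ⌋ then q ^ (i + j + 1) else 0

      excess : ℕ → ℕ → ℕ
      excess i k = if ⌊ a * i + b * k ≟ n ⌋ then q ^ i * (if ⌊ a ≤? k ⌋ then q * q ^ (k ∸ a) else 0) else 0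

      reassoc : ∀ i j → a * i + b * (a + j) ≡ a * i + b * j + a * b
      reassoc i j = solve 4 (λ a i b j → a :* i :+ b :* (a :+ j) := a :* i :+ b :* j :+ a :* b) refl a i b j

      good+excess : ∀ i k → good i k + excess i k ≡ all i k
      good+excess i k with a * i + b * k ≟ n
      ... | yes e = begin
        q ^ i * A k + q ^ i * _  ≡⟨ *-distribˡ-+ (q ^ i) (A k) _ ⟨
        q ^ i * (A k + _)        ≡⟨ cong (q ^ i *_) (recurrence k) ⟩
        q ^ i * q ^ k            ≡⟨ ^-distribˡ-+-* q i k ⟨
        q ^ (i + k)              ≡⟨ cong (q ^_) (+-identityʳ (i + k)) ⟨
        q ^ (i + k + 0)          ≡⟨ if-yes (a * i + b * k + 0 ≟ n) (trans (+-identityʳ _) e) ⟨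
        all i k                  ∎
        where open ≡-Reasoning
      ... | no ¬e = sym (if-no (a * i + b * k + 0 ≟ n) λ e → ¬e (trans (sym (+-identityʳ _)) e))

      excess-low : ∀ i k → k < a → excess i k ≡ 0
      excess-low i k k<a with a * i + b * k ≟ n
      ... | yes _ = trans (cong (q ^ i *_) (if-no (a ≤? k) (<⇒≱ k<a))) (*-zeroʳ (q ^ i))
      ... | no  _ = refl

      excess-shift : ∀ i j → excess i (a + j) ≡ shifted i j
      excess-shift i j with a * i + b * j + a * b ≟ n
      ... | yes e = begin
        excess i (a + j)                   ≡⟨ if-yes (a * i + b * (a + j) ≟ n) (trans (reassoc i j) e) ⟩
        q ^ i * (if ⌊ a ≤? a + j ⌋ then q * q ^ (a + j ∸ a) else 0) ≡⟨ cong (q ^ i *_) (if-yes (a ≤? a + j) (m≤m+n a j)) ⟩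
        q ^ i * (q * q ^ (a + j ∸ a))      ≡⟨ cong (λ t → q ^ i * (q * q ^ t)) (m+n∸m≡n a j) ⟩
        q ^ i * (q * q ^ j)                ≡⟨ solve 3 (λ x q y → x :* (q :* y) := (x :* y) :* (q :* con 1)) refl (q ^ i) q (q ^ j) ⟩
        (q ^ i * q ^ j) * (q * 1)          ≡⟨ cong (_* (q * 1)) (^-distribˡ-+-* q i j) ⟨
        q ^ (i + j) * q ^ 1                ≡⟨ ^-distribˡ-+-* q (i + j) 1 ⟨
        q ^ (i + j + 1)                    ∎
        where open ≡-Reasoning
      ... | no ¬e = if-no (a * i + b * (a + j) ≟ n) λ e → ¬e (trans (sym (reassoc i j)) e)

      shifted-high : ∀ i j → n < j + a → shifted i j ≡ 0
      shifted-high i j n<j+a = if-no (a * i + b * j + a * b ≟ n) λ e → <⇒≱ n<j+a (subst (j + a ≤_) e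
        (≤-trans (+-mono-≤ (m≤n*m j b) (m≤m*n a b)) (+-monoˡ-≤ (a * b) (m≤n+m (b * j) (a * i)))))
        where instance _ = >-nonZero 0<b

      reindex : ∀ i → ∑< (suc n) (excess i) ≡ ∑< (suc n) (shifted i)
      reindex i with a ≤? suc n
      ... | yes a≤N = trans (∑<-shift (excess i) a≤N (excess-low i))
                            (trans (∑<-cong (suc n ∸ a) λ j _ → excess-shift i j)
                                   (sym (∑<-truncate (shifted i) (m∸n≤m (suc n) a) λ j N∸a≤j _ →
                                     shifted-high i j (N≤j+a N∸a≤j))))
        where
          N≤j+a : ∀ {j} → suc n ∸ a ≤ j → suc n ≤ j + a
          N≤j+a {j} N∸a≤j = ≤-trans (≤-reflexive (sym (m∸n+n≡m a≤N))) (+-monoˡ-≤ a N∸a≤j)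
      ... | no a≰N = trans (∑<-zero (suc n) λ k k<N → excess-low i k (<-trans k<N (≰⇒> a≰N)))
                           (sym (∑<-zero (suc n) λ j _ → shifted-high i j (≤-trans (<⇒≤ (≰⇒> a≰N)) (m≤n+m a j))))

      row : ∀ i → ∑< (suc n) (good i) + ∑< (suc n) (shifted i) ≡ ∑< (suc n) (all i)
      row i = trans (cong (∑< (suc n) (good i) +_) (sym (reindex i)))
                    (trans (sym (∑<-+ (suc n) (good i) (excess i))) (∑<-cong (suc n) λ k _ → good+excess i k))

    shapeSum+shifted≡all : shapeSum q a b A n + S q a b (a * b) 1 n ≡ S q a b 0 0 n
    shapeSum+shifted≡all = begin
      shapeSum q a b A n + S q a b (a * b) 1 n
        ≡⟨ cong₂ _+_ (sum-upTo² (suc n) good) (sum-upTo² (suc n) shifted) ⟩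
      ∑< (suc n) (λ i → ∑< (suc n) (good i)) + ∑< (suc n) (λ i → ∑< (suc n) (shifted i))
        ≡⟨ ∑<-+ (suc n) (λ i → ∑< (suc n) (good i)) (λ i → ∑< (suc n) (shifted i)) ⟨
      ∑< (suc n) (λ i → ∑< (suc n) (good i) + ∑< (suc n) (shifted i))
        ≡⟨ ∑<-cong (suc n) (λ i _ → row i) ⟩
      ∑< (suc n) (λ i → ∑< (suc n) (all i))
        ≡⟨ sum-upTo² (suc n) all ⟨
      S q a b 0 0 n
        ∎
      where open ≡-Reasoning

open Arithmetic

module PolynomialRing {q : ℕ} (F : FiniteField q) where
  open FiniteField F
  open IsCommutativeRing isCommutativeRing
    using (+-identityˡ; +-identityʳ; *-identityˡ; *-identityʳ; zeroˡ; zeroʳ; +-assoc; +-comm; *-assoc; *-comm;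
           -‿inverseʳ; distribˡ; distribʳ)
  open Poly F public

  commutativeRing : CommutativeRing _ _
  commutativeRing = record { isCommutativeRing = isCommutativeRing }

  open NonReflective (fromCommutativeRing commutativeRing (λ _ → nothing)) using (solve; _⊜_; _⊕_; _⊗_)

  -0#≡0# : - 0# ≡ 0#
  -0#≡0# = trans (sym (+-identityˡ _)) (-‿inverseʳ 0#)

  coeff : Pol → ℕ → Carrier
  coeff []      n       = 0#
  coeff (a ∷ f) zero    = a
  coeff (a ∷ f) (suc n) = coeff f n

  -- Coefficient lists are not normalised (trailing zeros are allowed), so polynomial algebra is done
  -- up to coefficientwise equality.
  infix 4 _≈_
  record _≈_ (f g : Pol) : Set where
    constructor coeffwise
    field coeff-≡ : ∀ n → coeff f n ≡ coeff g n
  open _≈_ public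

  ≈-refl : ∀ {f} → f ≈ f
  ≈-refl = coeffwise λ _ → refl

  ≈-sym : ∀ {f g} → f ≈ g → g ≈ f
  ≈-sym f≈g = coeffwise λ n → sym (coeff-≡ f≈g n)

  ≈-trans : ∀ {f g h} → f ≈ g → g ≈ h → f ≈ h
  ≈-trans f≈g g≈h = coeffwise λ n → trans (coeff-≡ f≈g n) (coeff-≡ g≈h n)

  ≡⇒≈ : ∀ {f g} → f ≡ g → f ≈ g
  ≡⇒≈ refl = ≈-refl

  ≈-isEquivalence : IsEquivalence _≈_
  ≈-isEquivalence = record { refl = ≈-refl ; sym = ≈-sym ; trans = ≈-trans }

  ≈-setoid : Setoid _ _
  ≈-setoid = record { isEquivalence = ≈-isEquivalence }

  module ≈-Reasoning = SetoidReasoning ≈-setoid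

  ∷-cong : ∀ {a b f g} → a ≡ b → f ≈ g → a ∷ f ≈ b ∷ g
  ∷-cong a≡b f≈g = coeffwise λ { zero → a≡b ; (suc n) → coeff-≡ f≈g n }

  ∷-injective : ∀ {a b f g} → a ∷ f ≈ b ∷ g → a ≡ b × f ≈ g
  ∷-injective h = coeff-≡ h zero , coeffwise λ n → coeff-≡ h (suc n)

  ∷≈[]⇒ : ∀ {a f} → a ∷ f ≈ [] → a ≡ 0# × f ≈ []
  ∷≈[]⇒ h = coeff-≡ h zero , coeffwise λ n → coeff-≡ h (suc n)

  infixr 25 _·_
  infix 25 -ₚ_
  _·_ : Carrier → Pol → Pol
  c · f = map (c *_) f

  -ₚ_ : Pol → Pol
  -ₚ f = map -_ f

  1ₚ : Pol
  1ₚ = [ 1# ]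

  coeff-+ₚ : ∀ f g n → coeff (f +ₚ g) n ≡ coeff f n + coeff g n
  coeff-+ₚ []      g       n       = sym (+-identityˡ _)
  coeff-+ₚ (a ∷ f) []      n       = sym (+-identityʳ _)
  coeff-+ₚ (a ∷ f) (b ∷ g) zero    = refl
  coeff-+ₚ (a ∷ f) (b ∷ g) (suc n) = coeff-+ₚ f g n

  coeff-· : ∀ c f n → coeff (c · f) n ≡ c * coeff f n
  coeff-· c []      n       = sym (zeroʳ c)
  coeff-· c (a ∷ f) zero    = refl
  coeff-· c (a ∷ f) (suc n) = coeff-· c f n

  coeff--ₚ : ∀ f n → coeff (-ₚ f) n ≡ - coeff f n
  coeff--ₚ []      n       = sym -0#≡0#
  coeff--ₚ (a ∷ f) zero    = refl
  coeff--ₚ (a ∷ f) (suc n) = coeff--ₚ f n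

  coeff-*ₚ-zero : ∀ a f g → coeff ((a ∷ f) *ₚ g) zero ≡ a * coeff g zero
  coeff-*ₚ-zero a f g = trans (coeff-+ₚ (a · g) (0# ∷ (f *ₚ g)) zero) (trans (+-identityʳ _) (coeff-· a g zero))

  coeff-*ₚ-suc : ∀ a f g n → coeff ((a ∷ f) *ₚ g) (suc n) ≡ a * coeff g (suc n) + coeff (f *ₚ g) n
  coeff-*ₚ-suc a f g n = trans (coeff-+ₚ (a · g) (0# ∷ (f *ₚ g)) (suc n)) (cong (_+ coeff (f *ₚ g) n) (coeff-· a g (suc n)))

  +ₚ-cong : ∀ {f f′ g g′} → f ≈ f′ → g ≈ g′ → f +ₚ g ≈ f′ +ₚ g′
  +ₚ-cong {f} {f′} {g} {g′} f≈f′ g≈g′ = coeffwise λ n → begin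
    coeff (f +ₚ g) n           ≡⟨ coeff-+ₚ f g n ⟩
    coeff f n + coeff g n      ≡⟨ cong₂ _+_ (coeff-≡ f≈f′ n) (coeff-≡ g≈g′ n) ⟩
    coeff f′ n + coeff g′ n    ≡⟨ coeff-+ₚ f′ g′ n ⟨
    coeff (f′ +ₚ g′) n         ∎
    where open ≡-Reasoning

  ·-cong : ∀ c {f g} → f ≈ g → c · f ≈ c · g
  ·-cong c {f} {g} f≈g = coeffwise λ n →
    trans (coeff-· c f n) (trans (cong (c *_) (coeff-≡ f≈g n)) (sym (coeff-· c g n)))

  -ₚ-cong : ∀ {f g} → f ≈ g → -ₚ f ≈ -ₚ g
  -ₚ-cong {f} {g} f≈g = coeffwise λ n →
    trans (coeff--ₚ f n) (trans (cong -_ (coeff-≡ f≈g n)) (sym (coeff--ₚ g n)))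

  +ₚ-assoc : ∀ f g h → (f +ₚ g) +ₚ h ≈ f +ₚ (g +ₚ h)
  +ₚ-assoc f g h = coeffwise λ n → begin
    coeff ((f +ₚ g) +ₚ h) n                ≡⟨ coeff-+ₚ (f +ₚ g) h n ⟩
    coeff (f +ₚ g) n + coeff h n           ≡⟨ cong (_+ coeff h n) (coeff-+ₚ f g n) ⟩
    (coeff f n + coeff g n) + coeff h n    ≡⟨ +-assoc _ _ _ ⟩
    coeff f n + (coeff g n + coeff h n)    ≡⟨ cong (coeff f n +_) (coeff-+ₚ g h n) ⟨
    coeff f n + coeff (g +ₚ h) n           ≡⟨ coeff-+ₚ f (g +ₚ h) n ⟨
    coeff (f +ₚ (g +ₚ h)) n                ∎
    where open ≡-Reasoning

  +ₚ-comm : ∀ f g → f +ₚ g ≈ g +ₚ f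
  +ₚ-comm f g = coeffwise λ n → trans (coeff-+ₚ f g n) (trans (+-comm _ _) (sym (coeff-+ₚ g f n)))

  +ₚ-identityˡ : ∀ f → [] +ₚ f ≈ f
  +ₚ-identityˡ f = ≈-refl

  +ₚ-identityʳ : ∀ f → f +ₚ [] ≈ f
  +ₚ-identityʳ f = coeffwise λ n → trans (coeff-+ₚ f [] n) (+-identityʳ _)

  -ₚ‿inverseʳ : ∀ f → f +ₚ -ₚ f ≈ []
  -ₚ‿inverseʳ f = coeffwise λ n →
    trans (coeff-+ₚ f (-ₚ f) n) (trans (cong (coeff f n +_) (coeff--ₚ f n)) (-‿inverseʳ _))

  -ₚ‿inverseˡ : ∀ f → -ₚ f +ₚ f ≈ []
  -ₚ‿inverseˡ f = ≈-trans (+ₚ-comm (-ₚ f) f) (-ₚ‿inverseʳ f)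

  0#∷[]≈[] : 0# ∷ [] ≈ []
  0#∷[]≈[] = coeffwise λ { zero → refl ; (suc n) → refl }

  0·f≈[] : ∀ f → 0# · f ≈ []
  0·f≈[] f = coeffwise λ n → trans (coeff-· 0# f n) (zeroˡ _)

  ·-distrib-+ₚ : ∀ c f g → c · (f +ₚ g) ≈ (c · f) +ₚ (c · g)
  ·-distrib-+ₚ c f g = coeffwise λ n → begin
    coeff (c · (f +ₚ g)) n                ≡⟨ coeff-· c (f +ₚ g) n ⟩
    c * coeff (f +ₚ g) n                  ≡⟨ cong (c *_) (coeff-+ₚ f g n) ⟩
    c * (coeff f n + coeff g n)           ≡⟨ distribˡ c _ _ ⟩
    c * coeff f n + c * coeff g n         ≡⟨ cong₂ _+_ (coeff-· c f n) (coeff-· c g n) ⟨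
    coeff (c · f) n + coeff (c · g) n     ≡⟨ coeff-+ₚ (c · f) (c · g) n ⟨
    coeff ((c · f) +ₚ (c · g)) n             ∎
    where open ≡-Reasoning

  ·-assoc : ∀ c d f → c · (d · f) ≈ (c * d) · f
  ·-assoc c d f = coeffwise λ n →
    trans (coeff-· c (d · f) n) (trans (cong (c *_) (coeff-· d f n))
      (trans (sym (*-assoc c d _)) (sym (coeff-· (c * d) f n))))

  *ₚ-zeroˡ : ∀ f g → f ≈ [] → f *ₚ g ≈ []
  *ₚ-zeroˡ []      g f≈[] = ≈-refl
  *ₚ-zeroˡ (a ∷ f) g a∷f≈[] =
    ≈-trans (+ₚ-cong (≈-trans (≡⇒≈ (cong (_· g) a≡0)) (0·f≈[] g)) (∷-cong refl (*ₚ-zeroˡ f g f≈[])))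
            0#∷[]≈[]
    where
      a≡0 = proj₁ (∷≈[]⇒ a∷f≈[])
      f≈[] = proj₂ (∷≈[]⇒ a∷f≈[])

  *ₚ-zeroʳ : ∀ f → f *ₚ [] ≈ []
  *ₚ-zeroʳ []      = ≈-refl
  *ₚ-zeroʳ (a ∷ f) = coeffwise λ { zero → refl ; (suc n) → coeff-≡ (*ₚ-zeroʳ f) n }

  *ₚ-congʳ : ∀ {f f′} g → f ≈ f′ → f *ₚ g ≈ f′ *ₚ g
  *ₚ-congʳ {[]}    {f′}     g f≈f′ = ≈-sym (*ₚ-zeroˡ f′ g (≈-sym f≈f′))
  *ₚ-congʳ {a ∷ f} {[]}     g f≈f′ = *ₚ-zeroˡ (a ∷ f) g f≈f′
  *ₚ-congʳ {a ∷ f} {b ∷ f′} g f≈f′ =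
    +ₚ-cong (≡⇒≈ (cong (_· g) (proj₁ (∷-injective f≈f′))))
            (∷-cong refl (*ₚ-congʳ g (proj₂ (∷-injective f≈f′))))

  *ₚ-congˡ : ∀ f {g g′} → g ≈ g′ → f *ₚ g ≈ f *ₚ g′
  *ₚ-congˡ []      g≈g′ = ≈-refl
  *ₚ-congˡ (a ∷ f) g≈g′ = +ₚ-cong (·-cong a g≈g′) (∷-cong refl (*ₚ-congˡ f g≈g′))

  *ₚ-cong : ∀ {f f′ g g′} → f ≈ f′ → g ≈ g′ → f *ₚ g ≈ f′ *ₚ g′
  *ₚ-cong {f} {f′} {g} f≈f′ g≈g′ = ≈-trans (*ₚ-congʳ g f≈f′) (*ₚ-congˡ f′ g≈g′)

  1·f≈f : ∀ f → 1# · f ≈ f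
  1·f≈f f = coeffwise λ n → trans (coeff-· 1# f n) (*-identityˡ _)

  *ₚ-identityˡ : ∀ g → 1ₚ *ₚ g ≈ g
  *ₚ-identityˡ g = ≈-trans (+ₚ-cong (1·f≈f g) 0#∷[]≈[]) (+ₚ-identityʳ g)

  *ₚ-identityʳ : ∀ f → f *ₚ 1ₚ ≈ f
  *ₚ-identityʳ []      = ≈-refl
  *ₚ-identityʳ (a ∷ f) = coeffwise λ
    { zero    → trans (+-identityʳ _) (*-identityʳ a)
    ; (suc n) → trans (coeff-*ₚ-suc a f 1ₚ n) (trans (cong₂ _+_ (zeroʳ a) (coeff-≡ (*ₚ-identityʳ f) n)) (+-identityˡ _))
    }

  *ₚ-distribʳ : ∀ h f g → (f +ₚ g) *ₚ h ≈ (f *ₚ h) +ₚ (g *ₚ h)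
  *ₚ-distribʳ h []      g       = ≈-refl
  *ₚ-distribʳ h (a ∷ f) []      = ≈-sym (+ₚ-identityʳ _)
  *ₚ-distribʳ h (a ∷ f) (b ∷ g) = coeffwise λ
    { zero → begin
        coeff (((a + b) ∷ (f +ₚ g)) *ₚ h) 0               ≡⟨ coeff-*ₚ-zero (a + b) (f +ₚ g) h ⟩
        (a + b) * coeff h 0                                ≡⟨ distribʳ _ a b ⟩
        a * coeff h 0 + b * coeff h 0                      ≡⟨ cong₂ _+_ (coeff-*ₚ-zero a f h) (coeff-*ₚ-zero b g h) ⟨
        coeff ((a ∷ f) *ₚ h) 0 + coeff ((b ∷ g) *ₚ h) 0    ≡⟨ coeff-+ₚ ((a ∷ f) *ₚ h) ((b ∷ g) *ₚ h) 0 ⟨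
        coeff (((a ∷ f) *ₚ h) +ₚ ((b ∷ g) *ₚ h)) 0             ∎
    ; (suc n) → let hₙ = coeff h (suc n) in begin
        coeff (((a + b) ∷ (f +ₚ g)) *ₚ h) (suc n)          ≡⟨ coeff-*ₚ-suc (a + b) (f +ₚ g) h n ⟩
        (a + b) * hₙ + coeff ((f +ₚ g) *ₚ h) n             ≡⟨ cong ((a + b) * hₙ +_) (coeff-≡ (*ₚ-distribʳ h f g) n) ⟩
        (a + b) * hₙ + coeff ((f *ₚ h) +ₚ (g *ₚ h)) n         ≡⟨ cong ((a + b) * hₙ +_) (coeff-+ₚ (f *ₚ h) (g *ₚ h) n) ⟩
        (a + b) * hₙ + (coeff (f *ₚ h) n + coeff (g *ₚ h) n)
          ≡⟨ solve 5 (λ a b c x y → ((a ⊕ b) ⊗ c ⊕ (x ⊕ y)) ⊜ ((a ⊗ c ⊕ x) ⊕ (b ⊗ c ⊕ y))) refl a b hₙ _ _ ⟩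
        (a * hₙ + coeff (f *ₚ h) n) + (b * hₙ + coeff (g *ₚ h) n)
          ≡⟨ cong₂ _+_ (coeff-*ₚ-suc a f h n) (coeff-*ₚ-suc b g h n) ⟨
        coeff ((a ∷ f) *ₚ h) (suc n) + coeff ((b ∷ g) *ₚ h) (suc n)
          ≡⟨ coeff-+ₚ ((a ∷ f) *ₚ h) ((b ∷ g) *ₚ h) (suc n) ⟨
        coeff (((a ∷ f) *ₚ h) +ₚ ((b ∷ g) *ₚ h)) (suc n)       ∎
    }
    where open ≡-Reasoning

  *ₚ-consʳ : ∀ f b g → f *ₚ (b ∷ g) ≈ (b · f) +ₚ (0# ∷ (f *ₚ g))
  *ₚ-consʳ []      b g = ≈-sym 0#∷[]≈[]
  *ₚ-consʳ (a ∷ f) b g = ∷-cong (cong (_+ 0#) (*-comm a b)) (begin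
    (a · g) +ₚ (f *ₚ (b ∷ g))                  ≈⟨ +ₚ-cong (≈-refl {a · g}) (*ₚ-consʳ f b g) ⟩
    (a · g) +ₚ ((b · f) +ₚ (0# ∷ (f *ₚ g)))    ≈⟨ ≈-sym (+ₚ-assoc (a · g) (b · f) _) ⟩
    ((a · g) +ₚ (b · f)) +ₚ (0# ∷ (f *ₚ g))    ≈⟨ +ₚ-cong (+ₚ-comm (a · g) (b · f)) ≈-refl ⟩
    ((b · f) +ₚ (a · g)) +ₚ (0# ∷ (f *ₚ g))    ≈⟨ +ₚ-assoc (b · f) (a · g) _ ⟩
    (b · f) +ₚ ((a · g) +ₚ (0# ∷ (f *ₚ g)))    ∎)
    where open ≈-Reasoning

  *ₚ-comm : ∀ f g → f *ₚ g ≈ g *ₚ f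
  *ₚ-comm []      g = ≈-sym (*ₚ-zeroʳ g)
  *ₚ-comm (a ∷ f) g = ≈-trans (+ₚ-cong (≈-refl {a · g}) (∷-cong refl (*ₚ-comm f g))) (≈-sym (*ₚ-consʳ g a f))

  ·-*ₚ : ∀ c g h → (c · g) *ₚ h ≈ c · (g *ₚ h)
  ·-*ₚ c []      h = ≈-refl
  ·-*ₚ c (b ∷ g) h = ≈-trans (+ₚ-cong (≈-sym (·-assoc c b h)) (∷-cong (sym (zeroʳ c)) (·-*ₚ c g h)))
                             (≈-sym (·-distrib-+ₚ c (b · h) (0# ∷ (g *ₚ h))))

  0∷-*ₚ : ∀ f g → (0# ∷ f) *ₚ g ≈ 0# ∷ (f *ₚ g)
  0∷-*ₚ f g = +ₚ-cong (0·f≈[] g) ≈-refl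

  *ₚ-assoc : ∀ f g h → (f *ₚ g) *ₚ h ≈ f *ₚ (g *ₚ h)
  *ₚ-assoc []      g h = ≈-refl
  *ₚ-assoc (a ∷ f) g h = begin
    ((a · g) +ₚ (0# ∷ (f *ₚ g))) *ₚ h              ≈⟨ *ₚ-distribʳ h (a · g) _ ⟩
    ((a · g) *ₚ h) +ₚ ((0# ∷ (f *ₚ g)) *ₚ h)       ≈⟨ +ₚ-cong (·-*ₚ a g h) (0∷-*ₚ (f *ₚ g) h) ⟩
    (a · (g *ₚ h)) +ₚ (0# ∷ ((f *ₚ g) *ₚ h))       ≈⟨ +ₚ-cong (≈-refl {a · (g *ₚ h)}) (∷-cong refl (*ₚ-assoc f g h)) ⟩
    (a · (g *ₚ h)) +ₚ (0# ∷ (f *ₚ (g *ₚ h)))       ∎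
    where open ≈-Reasoning

  *ₚ-distribˡ : ∀ h f g → h *ₚ (f +ₚ g) ≈ (h *ₚ f) +ₚ (h *ₚ g)
  *ₚ-distribˡ h f g =
    ≈-trans (*ₚ-comm h (f +ₚ g)) (≈-trans (*ₚ-distribʳ h f g) (+ₚ-cong (*ₚ-comm f h) (*ₚ-comm g h)))

  isCommutativeRingₚ : IsCommutativeRing _≈_ _+ₚ_ _*ₚ_ -ₚ_ [] 1ₚ
  isCommutativeRingₚ = record
    { isRing = record
      { +-isAbelianGroup = record
        { isGroup = record
          { isMonoid = record
            { isSemigroup = record
              { isMagma = record { isEquivalence = ≈-isEquivalence ; ∙-cong = +ₚ-cong }
              ; assoc = +ₚ-assoc }
            ; identity = +ₚ-identityˡ , +ₚ-identityʳ }
          ; inverse = -ₚ‿inverseˡ , -ₚ‿inverseʳ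
          ; ⁻¹-cong = -ₚ-cong }
        ; comm = +ₚ-comm }
      ; *-cong = *ₚ-cong
      ; *-assoc = *ₚ-assoc
      ; *-identity = *ₚ-identityˡ , *ₚ-identityʳ
      ; distrib = *ₚ-distribˡ , *ₚ-distribʳ }
    ; *-comm = *ₚ-comm }

  ℙ : CommutativeRing _ _
  ℙ = record { isCommutativeRing = isCommutativeRingₚ }

module Degree {q : ℕ} (F : FiniteField q) where
  open FiniteField F
  open IsCommutativeRing isCommutativeRing using (+-identityˡ; +-identityʳ; *-identityˡ; zeroˡ; zeroʳ)
  open PolynomialRing F

  _≟_ : DecidableEquality Carrier
  _≟_ = inj⇒≟ (↔⇒↣ card)

  1#≢0# : 1# ≢ 0#
  1#≢0# 1≡0 = 0≢1 (sym 1≡0)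

  record DegreeBelow (d : ℕ) (f : Pol) : Set where
    constructor vanishesFrom
    field vanishes : ∀ n → d ≤ n → coeff f n ≡ 0#
  open DegreeBelow public

  record HasDegree (d : ℕ) (c : Carrier) (f : Pol) : Set where
    constructor hasDegree
    field below   : DegreeBelow (suc d) f
          leading : coeff f d ≡ c
  open HasDegree public

  IsMonic : ℕ → Pol → Set
  IsMonic d = HasDegree d 1#

  DegreeBelow-resp-≈ : ∀ {d f g} → f ≈ g → DegreeBelow d f → DegreeBelow d g
  DegreeBelow-resp-≈ f≈g f<d = vanishesFrom λ n d≤n → trans (sym (coeff-≡ f≈g n)) (vanishes f<d n d≤n)

  HasDegree-resp-≈ : ∀ {d c f g} → f ≈ g → HasDegree d c f → HasDegree d c g
  HasDegree-resp-≈ f≈g (hasDegree f<d lead) = hasDegree (DegreeBelow-resp-≈ f≈g f<d) (trans (sym (coeff-≡ f≈g _)) lead)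

  DegreeBelow-mono : ∀ {d d′ f} → d ≤ d′ → DegreeBelow d f → DegreeBelow d′ f
  DegreeBelow-mono d≤d′ f<d = vanishesFrom λ n d′≤n → vanishes f<d n (ℕ.≤-trans d≤d′ d′≤n)

  DegreeBelow-0 : ∀ {f} → DegreeBelow 0 f → f ≈ []
  DegreeBelow-0 f<0 = coeffwise λ n → vanishes f<0 n z≤n

  DegreeBelow-[] : ∀ d → DegreeBelow d []
  DegreeBelow-[] d = vanishesFrom λ _ _ → refl

  DegreeBelow-length : ∀ f → DegreeBelow (length f) f
  DegreeBelow-length f = vanishesFrom (vanish f)
    where
      vanish : ∀ f n → length f ≤ n → coeff f n ≡ 0#
      vanish []      n       _         = refl
      vanish (a ∷ f) (suc n) (s≤s f≤n) = vanish f n f≤n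

  DegreeBelow-tail : ∀ {d a f} → DegreeBelow (suc d) (a ∷ f) → DegreeBelow d f
  DegreeBelow-tail a∷f<d = vanishesFrom λ n d≤n → vanishes a∷f<d (suc n) (s≤s d≤n)

  DegreeBelow-∷ : ∀ {d a f} → DegreeBelow d f → DegreeBelow (suc d) (a ∷ f)
  DegreeBelow-∷ f<d = vanishesFrom λ { (suc n) (s≤s d≤n) → vanishes f<d n d≤n }

  DegreeBelow-+ₚ : ∀ {d f g} → DegreeBelow d f → DegreeBelow d g → DegreeBelow d (f +ₚ g)
  DegreeBelow-+ₚ {f = f} {g} f<d g<d = vanishesFrom λ n d≤n →
    trans (coeff-+ₚ f g n) (trans (cong₂ _+_ (vanishes f<d n d≤n) (vanishes g<d n d≤n)) (+-identityʳ _))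

  DegreeBelow-· : ∀ {d c f} → DegreeBelow d f → DegreeBelow d (c · f)
  DegreeBelow-· {c = c} {f} f<d = vanishesFrom λ n d≤n →
    trans (coeff-· c f n) (trans (cong (c *_) (vanishes f<d n d≤n)) (zeroʳ c))

  HasDegree-∷ : ∀ {d c a f} → HasDegree d c f → HasDegree (suc d) c (a ∷ f)
  HasDegree-∷ (hasDegree f<d lead) = hasDegree (DegreeBelow-∷ f<d) lead

  HasDegree-tail : ∀ {d c a f} → HasDegree (suc d) c (a ∷ f) → HasDegree d c f
  HasDegree-tail (hasDegree f<d lead) = hasDegree (DegreeBelow-tail f<d) lead

  HasDegree-+ₚ-lower : ∀ {d c f g} → DegreeBelow d g → HasDegree d c f → HasDegree d c (g +ₚ f)
  HasDegree-+ₚ-lower {d} {c} {f} {g} g<d (hasDegree f<d lead) =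
    hasDegree (DegreeBelow-+ₚ (DegreeBelow-mono (ℕ.n≤1+n d) g<d) f<d)
              (trans (coeff-+ₚ g f d) (trans (cong₂ _+_ (vanishes g<d d ℕ.≤-refl) lead) (+-identityˡ c)))

  HasDegree-· : ∀ {d c y f} → HasDegree d c f → HasDegree d (y * c) (y · f)
  HasDegree-· {d} {c} {y} {f} (hasDegree f<d lead) = hasDegree (DegreeBelow-· f<d) (trans (coeff-· y f d) (cong (y *_) lead))

  HasDegree-*ₚ : ∀ {d e c c′} f {g} → HasDegree d c f → HasDegree e c′ g → HasDegree (d ℕ.+ e) (c * c′) (f *ₚ g)
  HasDegree-*ₚ {c = c} {c′} [] (hasDegree _ lead) g° =
    hasDegree (DegreeBelow-[] _) (trans (sym (zeroˡ c′)) (cong (_* c′) lead))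
  HasDegree-*ₚ {zero} {e} {c} {c′} (a ∷ f) {g} (hasDegree f<1 lead) g° =
    HasDegree-resp-≈ (≈-sym a∷f*g≈a·g) (subst (λ x → HasDegree e (x * c′) (a · g)) lead (HasDegree-· g°))
    where
      open ≈-Reasoning
      a∷f*g≈a·g : (a ∷ f) *ₚ g ≈ a · g
      a∷f*g≈a·g = begin
        (a · g) +ₚ (0# ∷ (f *ₚ g))  ≈⟨ +ₚ-cong (≈-refl {a · g}) (∷-cong refl (*ₚ-zeroˡ f g (DegreeBelow-0 (DegreeBelow-tail f<1)))) ⟩
        (a · g) +ₚ (0# ∷ [])        ≈⟨ +ₚ-cong (≈-refl {a · g}) 0#∷[]≈[] ⟩
        (a · g) +ₚ []               ≈⟨ +ₚ-identityʳ (a · g) ⟩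
        a · g                       ∎
  HasDegree-*ₚ {suc d} {e} (a ∷ f) f° g° =
    HasDegree-+ₚ-lower (DegreeBelow-· (DegreeBelow-mono (s≤s (ℕ.m≤n+m e d)) (below g°)))
                       (HasDegree-∷ (HasDegree-*ₚ f (HasDegree-tail f°) g°))

  IsMonic-*ₚ : ∀ {d e f g} → IsMonic d f → IsMonic e g → IsMonic (d ℕ.+ e) (f *ₚ g)
  IsMonic-*ₚ {f = f} f° g° = subst (λ c → HasDegree _ c (f *ₚ _)) (*-identityˡ 1#) (HasDegree-*ₚ f f° g°)

  IsMonic-1ₚ : IsMonic 0 1ₚ
  IsMonic-1ₚ = hasDegree (vanishesFrom λ { (suc n) _ → refl }) refl

  degree-unique : ∀ {m m′ c c′ f} → HasDegree m c f → HasDegree m′ c′ f → c ≢ 0# → c′ ≢ 0# → m ≡ m′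
  degree-unique {m} {m′} (hasDegree f<m lead) (hasDegree f<m′ lead′) c≢0 c′≢0 with ℕ.<-cmp m m′
  ... | tri< m<m′ _ _ = ⊥-elim (c′≢0 (trans (sym lead′) (vanishes f<m m′ m<m′)))
  ... | tri≈ _ m≡m′ _ = m≡m′
  ... | tri> _ _ m′<m = ⊥-elim (c≢0 (trans (sym lead) (vanishes f<m′ m m′<m)))

  monic-degree-unique : ∀ {m m′ f} → IsMonic m f → IsMonic m′ f → m ≡ m′
  monic-degree-unique f° f°′ = degree-unique f° f°′ 1#≢0# 1#≢0#

  leading-unique : ∀ {m c c′ f} → HasDegree m c f → HasDegree m c′ f → c ≡ c′
  leading-unique (hasDegree _ lead) (hasDegree _ lead′) = trans (sym lead) lead′

  ≈[]⊎HasDegree : ∀ d f → DegreeBelow d f →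
                  f ≈ [] ⊎ Σ ℕ λ j → Σ Carrier λ c → j < d × c ≢ 0# × HasDegree j c f
  ≈[]⊎HasDegree zero    f f<0 = inj₁ (DegreeBelow-0 f<0)
  ≈[]⊎HasDegree (suc d) f f<d+1 with coeff f d ≟ 0#
  ... | no  c≢0 = inj₂ (d , coeff f d , ℕ.≤-refl , c≢0 , hasDegree f<d+1 refl)
  ... | yes c≡0 with ≈[]⊎HasDegree d f (vanishesFrom f<d)
    where
      f<d : ∀ n → d ≤ n → coeff f n ≡ 0#
      f<d n d≤n with ℕ.m≤n⇒m<n∨m≡n d≤n
      ... | inj₁ d<n  = vanishes f<d+1 n d<n
      ... | inj₂ refl = c≡0
  ...   | inj₁ f≈[]                 = inj₁ f≈[]
  ...   | inj₂ (j , c , j<d , c≢0 , f°) = inj₂ (j , c , ℕ.m≤n⇒m≤1+n j<d , c≢0 , f°)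

  normalise : ∀ {j c f} → c ≢ 0# → HasDegree j c f → Σ Carrier λ y → IsMonic j (y · f)
  normalise {c = c} c≢0 f° with inverse c c≢0
  ... | y , c*y≡1 = y , subst (λ x → HasDegree _ x _) (trans (*-comm y c) c*y≡1) (HasDegree-· f°)
    where open IsCommutativeRing isCommutativeRing using (*-comm)

  IsMonic-toPol : ∀ {d} (v : Monic d) → IsMonic d (toPol v)
  IsMonic-toPol Vec.[]       = IsMonic-1ₚ
  IsMonic-toPol (x Vec.∷ v) = HasDegree-∷ (IsMonic-toPol v)

  fromPol : (d : ℕ) → Pol → Monic d
  fromPol zero    g       = Vec.[]
  fromPol (suc d) []      = 0# Vec.∷ fromPol d []
  fromPol (suc d) (a ∷ g) = a Vec.∷ fromPol d g

  toPol-fromPol : ∀ d {g} → IsMonic d g → toPol (fromPol d g) ≈ g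
  toPol-fromPol zero {g} (hasDegree g<1 lead) =
    coeffwise λ { zero → sym lead ; (suc n) → sym (vanishes g<1 (suc n) (s≤s z≤n)) }
  toPol-fromPol (suc d) {[]}    (hasDegree _ lead) = ⊥-elim (0≢1 lead)
  toPol-fromPol (suc d) {a ∷ g} g° = ∷-cong refl (toPol-fromPol d (HasDegree-tail g°))

  toPol-injective : ∀ {d} (u v : Monic d) → toPol u ≈ toPol v → u ≡ v
  toPol-injective Vec.[]      Vec.[]      _ = refl
  toPol-injective (x Vec.∷ u) (y Vec.∷ v) u≈v =
    cong₂ Vec._∷_ (proj₁ (∷-injective u≈v)) (toPol-injective u v (proj₂ (∷-injective u≈v)))

  ≈∧length⇒≡ : ∀ {f g} → f ≈ g → length f ≡ length g → f ≡ g
  ≈∧length⇒≡ {[]}    {[]}    _   _     = refl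
  ≈∧length⇒≡ {a ∷ f} {b ∷ g} f≈g |f|≡|g| =
    cong₂ _∷_ (proj₁ (∷-injective f≈g)) (≈∧length⇒≡ (proj₂ (∷-injective f≈g)) (ℕ.suc-injective |f|≡|g|))

  length-toPol : ∀ {d} (v : Monic d) → length (toPol v) ≡ suc d
  length-toPol Vec.[]      = refl
  length-toPol (x Vec.∷ v) = cong suc (length-toPol v)

  length-+ₚ : ∀ f g → length (f +ₚ g) ≡ length f ⊔ length g
  length-+ₚ []      g       = refl
  length-+ₚ (a ∷ f) []      = refl
  length-+ₚ (a ∷ f) (b ∷ g) = cong suc (length-+ₚ f g)

  length-*ₚ : ∀ a f b g → length ((a ∷ f) *ₚ (b ∷ g)) ≡ suc (length f ℕ.+ length g)
  length-*ₚ a []       b g = cong suc (trans (length-+ₚ (a · g) []) (trans (ℕ.⊔-identityʳ _) (length-map _ g)))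
  length-*ₚ a (a′ ∷ f) b g = cong suc (trans (length-+ₚ (a · g) ((a′ ∷ f) *ₚ (b ∷ g)))
    (trans (cong₂ _⊔_ (length-map _ g) (length-*ₚ a′ f b g)) (ℕ.m≤n⇒m⊔n≡n (ℕ.m≤n+m _ _))))

module Division {q : ℕ} (F : FiniteField q) where
  open FiniteField F
  open IsCommutativeRing isCommutativeRing using (+-identityˡ; +-identityʳ; *-identityʳ; zeroʳ; -‿inverseʳ)
  open PolynomialRing F
  open Degree F
  open CommutativeSemigroupDivisibility (CommutativeRing.*-commutativeSemigroup ℙ) public
    using (_∣_; _∤_; _,_; ∣ʳ-trans; ∣ʳ-respʳ-≈; ∣ʳ-respˡ-≈; x∣xy; x∣ʳy⇒x∣ʳzy; ∙-cong-∣)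
  open MonoidDivisibility (CommutativeRing.*-monoid ℙ) public using (∣ʳ-refl)
  open GroupProperties (CommutativeRing.+-group ℙ) using (x∙y⁻¹≈ε⇒x≈y)
  open AbelianGroupProperties (CommutativeRing.+-abelianGroup ℙ) using (xyx⁻¹≈y)
  open RingProperties (CommutativeRing.ring ℙ) using ([y-z]x≈yx-zx)
  open NonReflective (fromCommutativeRing ℙ (λ _ → nothing)) using (solve; _⊜_; _⊕_; _⊗_; ⊝_)

  [c]*ₚf≈c·f : ∀ c f → [ c ] *ₚ f ≈ c · f
  [c]*ₚf≈c·f c f = ≈-trans (+ₚ-cong (≈-refl {c · f}) 0#∷[]≈[]) (+ₚ-identityʳ (c · f))

  cancel-leading : ∀ {d p s} → IsMonic d p → DegreeBelow (suc d) s → DegreeBelow d (s +ₚ -ₚ (coeff s d · p))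
  cancel-leading {d} {p} {s} p° s<d+1 = vanishesFrom λ n d≤n → begin
    coeff (s +ₚ -ₚ (c · p)) n   ≡⟨ coeff-+ₚ s _ n ⟩
    coeff s n + coeff (-ₚ (c · p)) n ≡⟨ cong (coeff s n +_) (trans (coeff--ₚ (c · p) n) (cong -_ (coeff-· c p n))) ⟩
    coeff s n + - (c * coeff p n) ≡⟨ top n d≤n ⟩
    0# ∎
    where
      open ≡-Reasoning
      c = coeff s d
      top : ∀ n → d ≤ n → coeff s n + - (c * coeff p n) ≡ 0#
      top n d≤n with ℕ.m≤n⇒m<n∨m≡n d≤n
      ... | inj₁ d<n  = trans (cong₂ (λ u v → u + - (c * v)) (vanishes s<d+1 n d<n) (vanishes (below p°) n d<n))
                              (trans (cong (λ u → 0# + - u) (zeroʳ c)) (trans (+-identityˡ _) -0#≡0#))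
      ... | inj₂ refl = trans (cong (λ v → c + - (c * v)) (leading p°))
                              (trans (cong (λ u → c + - u) (*-identityʳ c)) (-‿inverseʳ c))

  record DivMod (d : ℕ) (p f : Pol) : Set where
    constructor divMod
    field quotient remainder : Pol
          division          : f ≈ (quotient *ₚ p) +ₚ remainder
          remainder-below   : DegreeBelow d remainder

  divideBy : ∀ {d p} → IsMonic d p → ∀ f → DivMod d p f
  divideBy {d} {p} p° []      = divMod [] [] ≈-refl (DegreeBelow-[] d)
  divideBy {d} {p} p° (a ∷ f) with divideBy p° f
  ... | divMod t r f≈tp+r r<d =
        divMod ((0# ∷ t) +ₚ [ c ]) ((a ∷ r) +ₚ -ₚ (c · p)) a∷f≈ (cancel-leading p° (DegreeBelow-∷ r<d))
    where
      open ≈-Reasoning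
      c = coeff (a ∷ r) d
      a∷f≈ : a ∷ f ≈ (((0# ∷ t) +ₚ [ c ]) *ₚ p) +ₚ ((a ∷ r) +ₚ -ₚ (c · p))
      a∷f≈ = begin
        a ∷ f                                                       ≈⟨ ∷-cong (sym (+-identityˡ a)) f≈tp+r ⟩
        (0# ∷ (t *ₚ p)) +ₚ (a ∷ r)                                  ≈⟨ +ₚ-cong (≈-sym (0∷-*ₚ t p)) ≈-refl ⟩
        ((0# ∷ t) *ₚ p) +ₚ (a ∷ r)                                  ≈⟨ ≈-sym (+ₚ-identityʳ _) ⟩
        (((0# ∷ t) *ₚ p) +ₚ (a ∷ r)) +ₚ []
          ≈⟨ +ₚ-cong ≈-refl (≈-sym (≈-trans (+ₚ-cong ([c]*ₚf≈c·f c p) ≈-refl) (-ₚ‿inverseʳ (c · p)))) ⟩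
        (((0# ∷ t) *ₚ p) +ₚ (a ∷ r)) +ₚ (([ c ] *ₚ p) +ₚ -ₚ (c · p))
          ≈⟨ solve 5 (λ T C P R D → ((T ⊗ P ⊕ R) ⊕ (C ⊗ P ⊕ ⊝ D)) ⊜ ((T ⊕ C) ⊗ P ⊕ (R ⊕ ⊝ D)))
                     ≈-refl (0# ∷ t) [ c ] p (a ∷ r) (c · p) ⟩
        (((0# ∷ t) +ₚ [ c ]) *ₚ p) +ₚ ((a ∷ r) +ₚ -ₚ (c · p))       ∎

  low-degree-multiple≈[] : ∀ {d p r w} → IsMonic d p → DegreeBelow d r → r ≈ w *ₚ p → w ≈ []
  low-degree-multiple≈[] {d} {p} {r} {w} p° r<d r≈wp with ≈[]⊎HasDegree (length w) w (DegreeBelow-length w)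
  ... | inj₁ w≈[] = w≈[]
  ... | inj₂ (j , c , _ , c≢0 , w°) =
        ⊥-elim (c≢0 (trans (sym (*-identityʳ c)) (trans (sym (leading wp°)) (vanishes r<d (j ℕ.+ d) (ℕ.m≤n+m d j)))))
    where
      wp° : HasDegree (j ℕ.+ d) (c * 1#) r
      wp° = HasDegree-resp-≈ (≈-sym r≈wp) (HasDegree-*ₚ w w° p°)

  *ₚ-cancelʳ-monic : ∀ {d p x y} → IsMonic d p → x *ₚ p ≈ y *ₚ p → x ≈ y
  *ₚ-cancelʳ-monic {d} {p} {x} {y} p° xp≈yp = x∙y⁻¹≈ε⇒x≈y x y (low-degree-multiple≈[] p° (DegreeBelow-[] d) (begin
    []                              ≈⟨ ≈-sym (-ₚ‿inverseʳ (y *ₚ p)) ⟩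
    (y *ₚ p) +ₚ -ₚ (y *ₚ p)         ≈⟨ +ₚ-cong (≈-sym xp≈yp) ≈-refl ⟩
    (x *ₚ p) +ₚ -ₚ (y *ₚ p)         ≈⟨ ≈-sym ([y-z]x≈yx-zx p x y) ⟩
    (x +ₚ -ₚ y) *ₚ p                ∎))
    where open ≈-Reasoning

  ∣-remainder : ∀ {d a b p g} (r : DivMod d b a) → p ∣ (a *ₚ g) → p ∣ (b *ₚ g) → p ∣ (DivMod.remainder r *ₚ g)
  ∣-remainder {a = a} {b} {p} {g} (divMod t c a≈tb+c _) (u , up≈ag) (v , vp≈bg) = (u +ₚ -ₚ (t *ₚ v)) , (begin
    (u +ₚ -ₚ (t *ₚ v)) *ₚ p                       ≈⟨ [y-z]x≈yx-zx p u (t *ₚ v) ⟩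
    (u *ₚ p) +ₚ -ₚ ((t *ₚ v) *ₚ p)                ≈⟨ +ₚ-cong ≈-refl (-ₚ-cong (*ₚ-assoc t v p)) ⟩
    (u *ₚ p) +ₚ -ₚ (t *ₚ (v *ₚ p))                ≈⟨ +ₚ-cong up≈ag (-ₚ-cong (*ₚ-congˡ t vp≈bg)) ⟩
    (a *ₚ g) +ₚ -ₚ (t *ₚ (b *ₚ g))                ≈⟨ +ₚ-cong (*ₚ-congʳ g a≈tb+c) ≈-refl ⟩
    (((t *ₚ b) +ₚ c) *ₚ g) +ₚ -ₚ (t *ₚ (b *ₚ g))
      ≈⟨ +ₚ-cong (≈-trans (*ₚ-distribʳ g (t *ₚ b) c) (+ₚ-cong (*ₚ-assoc t b g) ≈-refl)) ≈-refl ⟩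
    ((t *ₚ (b *ₚ g)) +ₚ (c *ₚ g)) +ₚ -ₚ (t *ₚ (b *ₚ g))  ≈⟨ xyx⁻¹≈y (t *ₚ (b *ₚ g)) (c *ₚ g) ⟩
    c *ₚ g                                        ∎)
    where open ≈-Reasoning

  ∣-scaleˡ : ∀ {p g} y s → p ∣ (s *ₚ g) → p ∣ ((y · s) *ₚ g)
  ∣-scaleˡ {p} {g} y s p∣sg =
    ∣ʳ-respʳ-≈ (≈-trans ([c]*ₚf≈c·f y (s *ₚ g)) (≈-sym (·-*ₚ y s g))) (x∣ʳy⇒x∣ʳzy [ y ] p∣sg)

  ∣⇒remainder≈[] : ∀ {d p f} → IsMonic d p → (r : DivMod d p f) → p ∣ f → DivMod.remainder r ≈ []
  ∣⇒remainder≈[] {p = p} {f} p° (divMod t r f≈tp+r r<d) (u , up≈f) =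
    ≈-trans r≈[u-t]p (≈-trans (*ₚ-congʳ {u +ₚ -ₚ t} p (low-degree-multiple≈[] p° r<d r≈[u-t]p)) (*ₚ-zeroˡ [] p ≈-refl))
    where
      open ≈-Reasoning
      r≈[u-t]p : r ≈ (u +ₚ -ₚ t) *ₚ p
      r≈[u-t]p = begin
        r                                      ≈⟨ ≈-sym (xyx⁻¹≈y (t *ₚ p) r) ⟩
        ((t *ₚ p) +ₚ r) +ₚ -ₚ (t *ₚ p)         ≈⟨ +ₚ-cong (≈-trans (≈-sym f≈tp+r) (≈-sym up≈f)) ≈-refl ⟩
        (u *ₚ p) +ₚ -ₚ (t *ₚ p)                ≈⟨ ≈-sym ([y-z]x≈yx-zx p u t) ⟩
        (u +ₚ -ₚ t) *ₚ p                       ∎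

  remainder≈[]⇒∣ : ∀ {d p f} (r : DivMod d p f) → DivMod.remainder r ≈ [] → p ∣ f
  remainder≈[]⇒∣ (divMod t r f≈tp+r _) r≈[] =
    t , ≈-sym (≈-trans f≈tp+r (≈-trans (+ₚ-cong ≈-refl r≈[]) (+ₚ-identityʳ _)))

  _∣?_ : ∀ {d p} → IsMonic d p → ∀ f → Dec (p ∣ f)
  _∣?_ {d} p° f with divideBy p° f
  ... | r@(divMod _ rem _ rem<d) with ≈[]⊎HasDegree d rem rem<d
  ...   | inj₁ rem≈[] = yes (remainder≈[]⇒∣ r rem≈[])
  ...   | inj₂ (j , c , _ , c≢0 , rem°) =
          no λ p∣f → c≢0 (trans (sym (leading rem°)) (coeff-≡ (∣⇒remainder≈[] p° r p∣f) j))

  IsMonic-0⇒≈1ₚ : ∀ {r} → IsMonic 0 r → r ≈ 1ₚ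
  IsMonic-0⇒≈1ₚ (hasDegree r<1 lead) = coeffwise λ { zero → lead ; (suc n) → vanishes r<1 (suc n) (s≤s z≤n) }

  record IsIrreducible (d : ℕ) (p : Pol) : Set where
    field monic    : IsMonic d p
          positive : 0 < d
          divisors : ∀ {k r} → IsMonic k r → r ∣ p → k ≡ 0 ⊎ k ≡ d
  open IsIrreducible public

  -- Dividing p by r leaves a remainder s of smaller degree with p ∣ s g; normalising s, descend.
  ∣-low-degree-cancelˡ : ∀ {d p} → IsIrreducible d p → ∀ k {r g} → IsMonic k r → k < d → p ∣ (r *ₚ g) → p ∣ g
  ∣-low-degree-cancelˡ {d} {p} p° = <-rec _ step
    where
      step : ∀ k → (∀ {j} → j < k → ∀ {r g} → IsMonic j r → j < d → p ∣ (r *ₚ g) → p ∣ g) →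
             ∀ {r g} → IsMonic k r → k < d → p ∣ (r *ₚ g) → p ∣ g
      step zero    _   {r} {g} r° _   p∣rg = ∣ʳ-respʳ-≈ (≈-trans (*ₚ-congʳ g (IsMonic-0⇒≈1ₚ r°)) (*ₚ-identityˡ g)) p∣rg
      step (suc k) rec {r} {g} r° k<d p∣rg with divideBy r° p
      ... | rp@(divMod t s p≈tr+s s<k) with ≈[]⊎HasDegree (suc k) s s<k
      ...   | inj₁ s≈[] with divisors p° r° (remainder≈[]⇒∣ rp s≈[])
      ...     | inj₂ refl = ⊥-elim (ℕ.<-irrefl refl k<d)
      step (suc k) rec {r} {g} r° k<d p∣rg | rp@(divMod t s p≈tr+s _) | inj₂ (j , c , j<k , c≢0 , s°) with normalise c≢0 s°
      ...   | y , ys° = rec j<k ys° (ℕ.<-trans j<k k<d) (∣-scaleˡ y s (∣-remainder rp (x∣xy p g) p∣rg))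

  euclid : ∀ {d p f g} → IsIrreducible d p → p ∣ (f *ₚ g) → p ∣ f ⊎ p ∣ g
  euclid {d} {p} {f} {g} p° p∣fg with divideBy (monic p°) f
  ... | fp@(divMod t r f≈tp+r r<d) with ≈[]⊎HasDegree d r r<d
  ...   | inj₁ r≈[] = inj₁ (remainder≈[]⇒∣ fp r≈[])
  ...   | inj₂ (j , c , j<d , c≢0 , r°) with normalise c≢0 r°
  ...     | y , yr° = inj₂ (∣-low-degree-cancelˡ p° j yr° j<d (∣-scaleˡ y r (∣-remainder fp p∣fg (x∣xy p g))))

  IsIrreducible-resp-≈ : ∀ {d p p′} → p ≈ p′ → IsIrreducible d p → IsIrreducible d p′
  IsIrreducible-resp-≈ p≈p′ p° = record
    { monic    = HasDegree-resp-≈ p≈p′ (monic p°)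
    ; positive = positive p°
    ; divisors = λ r° r∣p′ → divisors p° r° (∣ʳ-respʳ-≈ (≈-sym p≈p′) r∣p′)
    }

module Valuations {q : ℕ} (F : FiniteField q) where
  open FiniteField F
  open IsCommutativeRing isCommutativeRing using (*-identityʳ)
  open PolynomialRing F
  open Degree F
  open Division F
  open CommutativeSemigroupProperties (CommutativeRing.*-commutativeSemigroup ℙ) using (interchange)

  IsMonic-^ₚ : ∀ {d p} → IsMonic d p → ∀ m → IsMonic (m ℕ.* d) (p ^ₚ m)
  IsMonic-^ₚ p° zero    = IsMonic-1ₚ
  IsMonic-^ₚ p° (suc m) = IsMonic-*ₚ p° (IsMonic-^ₚ p° m)

  ^ₚ-congˡ : ∀ {f g} m → f ≈ g → f ^ₚ m ≈ g ^ₚ m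
  ^ₚ-congˡ zero    f≈g = ≈-refl
  ^ₚ-congˡ (suc m) f≈g = *ₚ-cong f≈g (^ₚ-congˡ m f≈g)

  ^ₚ-homo-*ₚ : ∀ f m n → f ^ₚ (m ℕ.+ n) ≈ (f ^ₚ m) *ₚ (f ^ₚ n)
  ^ₚ-homo-*ₚ f zero    n = ≈-sym (*ₚ-identityˡ (f ^ₚ n))
  ^ₚ-homo-*ₚ f (suc m) n = ≈-trans (*ₚ-congˡ f (^ₚ-homo-*ₚ f m n)) (≈-sym (*ₚ-assoc f (f ^ₚ m) (f ^ₚ n)))

  ^ₚ-distrib-*ₚ : ∀ f g m → (f *ₚ g) ^ₚ m ≈ (f ^ₚ m) *ₚ (g ^ₚ m)
  ^ₚ-distrib-*ₚ f g zero    = ≈-sym (*ₚ-identityˡ 1ₚ)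
  ^ₚ-distrib-*ₚ f g (suc m) = ≈-trans (*ₚ-congˡ (f *ₚ g) (^ₚ-distrib-*ₚ f g m)) (interchange f g (f ^ₚ m) (g ^ₚ m))

  ^ₚ-assocʳ : ∀ f m n → (f ^ₚ m) ^ₚ n ≈ f ^ₚ (n ℕ.* m)
  ^ₚ-assocʳ f m zero    = ≈-refl
  ^ₚ-assocʳ f m (suc n) = ≈-trans (*ₚ-congˡ (f ^ₚ m) (^ₚ-assocʳ f m n)) (≈-sym (^ₚ-homo-*ₚ f m (n ℕ.* m)))

  ^ₚ-distrib-*ₚ-^ₚ : ∀ g p i c → (g *ₚ (p ^ₚ i)) ^ₚ c ≈ (g ^ₚ c) *ₚ (p ^ₚ (c ℕ.* i))
  ^ₚ-distrib-*ₚ-^ₚ g p i c = ≈-trans (^ₚ-distrib-*ₚ g (p ^ₚ i) c) (*ₚ-congˡ (g ^ₚ c) (^ₚ-assocʳ p i c))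

  ^ₚ-1 : ∀ f → f ^ₚ 1 ≈ f
  ^ₚ-1 f = *ₚ-identityʳ f

  1ₚ-^ₚ : ∀ m → 1ₚ ^ₚ m ≈ 1ₚ
  1ₚ-^ₚ zero    = ≈-refl
  1ₚ-^ₚ (suc m) = ≈-trans (*ₚ-identityˡ (1ₚ ^ₚ m)) (1ₚ-^ₚ m)

  ^ₚ-∣ : ∀ f {k m} → k ≤ m → f ^ₚ k ∣ f ^ₚ m
  ^ₚ-∣ f {k} {m} k≤m = f ^ₚ (m ℕ.∸ k) , (begin
    (f ^ₚ (m ℕ.∸ k)) *ₚ (f ^ₚ k)  ≈⟨ ≈-sym (^ₚ-homo-*ₚ f (m ℕ.∸ k) k) ⟩
    f ^ₚ ((m ℕ.∸ k) ℕ.+ k)       ≡⟨ cong (f ^ₚ_) (ℕ.m∸n+n≡m k≤m) ⟩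
    f ^ₚ m                       ∎)
    where open ≈-Reasoning

  ∣-^ₚ : ∀ {f g} m → f ∣ g → f ^ₚ m ∣ g ^ₚ m
  ∣-^ₚ zero    f∣g = ∣ʳ-refl
  ∣-^ₚ (suc m) f∣g = ∙-cong-∣ f∣g (∣-^ₚ m f∣g)

  ∣⇒∣-^ₚ : ∀ {f g} m → 0 < m → f ∣ g → f ∣ g ^ₚ m
  ∣⇒∣-^ₚ {g = g} (suc m) _ f∣g = ∣ʳ-trans f∣g (x∣xy g (g ^ₚ m))

  monic-cofactor : ∀ {d n p f} → IsMonic d p → IsMonic n f → ((t , _) : p ∣ f) → Σ ℕ λ e → e ℕ.+ d ≡ n × IsMonic e t
  monic-cofactor {d} {n} {p} {f} p° f° (t , tp≈f) with ≈[]⊎HasDegree (length t) t (DegreeBelow-length t)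
  ... | inj₁ t≈[] = ⊥-elim (0≢1 (trans (sym (coeff-≡ f≈[] n)) (leading f°)))
    where f≈[] = ≈-trans (≈-sym tp≈f) (*ₚ-zeroˡ t p t≈[])
  ... | inj₂ (j , c , _ , c≢0 , t°) = j , j+d≡n , subst (λ x → HasDegree j x t) c≡1 t°
    where
      tp° : HasDegree (j ℕ.+ d) (c * 1#) f
      tp° = HasDegree-resp-≈ tp≈f (HasDegree-*ₚ t t° p°)
      c*1≢0 : c * 1# ≢ 0#
      c*1≢0 c*1≡0 = c≢0 (trans (sym (*-identityʳ c)) c*1≡0)
      j+d≡n : j ℕ.+ d ≡ n
      j+d≡n = degree-unique tp° f° c*1≢0 1#≢0#
      c≡1 : c ≡ 1#
      c≡1 = trans (sym (*-identityʳ c)) (leading-unique tp° (subst (λ k → HasDegree k 1# f) (sym j+d≡n) f°))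

  positive-degree-∤1ₚ : ∀ {d p} → IsMonic d p → 0 < d → p ∤ 1ₚ
  positive-degree-∤1ₚ {d} p° 0<d (t , tp≈1) with monic-cofactor p° IsMonic-1ₚ (t , tp≈1)
  ... | e , e+d≡0 , _ = ℕ.<-irrefl refl (ℕ.<-≤-trans 0<d (ℕ.≤-trans (ℕ.m≤n+m d e) (ℕ.≤-reflexive e+d≡0)))

  record Valuation (p f : Pol) (m : ℕ) : Set where
    constructor valuation
    field cofactor      : Pol
          factorisation : cofactor *ₚ (p ^ₚ m) ≈ f
          ∤cofactor     : p ∤ cofactor
  open Valuation public

  Valuation-resp-≈ : ∀ {p f f′ m} → f ≈ f′ → Valuation p f m → Valuation p f′ m
  Valuation-resp-≈ f≈f′ (valuation t tpᵐ≈f p∤t) = valuation t (≈-trans tpᵐ≈f f≈f′) p∤t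

  Valuation-respₚ-≈ : ∀ {p p′ f m} → p ≈ p′ → Valuation p f m → Valuation p′ f m
  Valuation-respₚ-≈ {m = m} p≈p′ (valuation t tpᵐ≈f p∤t) =
    valuation t (≈-trans (*ₚ-congˡ t (^ₚ-congˡ m (≈-sym p≈p′))) tpᵐ≈f) (λ p′∣t → p∤t (∣ʳ-respˡ-≈ (≈-sym p≈p′) p′∣t))

  ∤⇒Valuation-0 : ∀ {p f} → p ∤ f → Valuation p f 0
  ∤⇒Valuation-0 {f = f} p∤f = valuation f (*ₚ-identityʳ f) p∤f

  Valuation⇒∣ : ∀ {p f m k} → Valuation p f m → k ≤ m → p ^ₚ k ∣ f
  Valuation⇒∣ {p} v k≤m = ∣ʳ-trans (^ₚ-∣ p k≤m) (cofactor v , factorisation v)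

  ∣⇒≤Valuation : ∀ {d p f m k} → IsMonic d p → Valuation p f m → p ^ₚ k ∣ f → k ≤ m
  ∣⇒≤Valuation {d} {p} {f} {m} {k} p° (valuation t tpᵐ≈f p∤t) pᵏ∣f with ℕ.≤-<-connex k m
  ... | inj₁ k≤m = k≤m
  ... | inj₂ m<k with ∣ʳ-trans (^ₚ-∣ p m<k) pᵏ∣f
  ...   | (u , upᵐ⁺¹≈f) = ⊥-elim (p∤t (u , *ₚ-cancelʳ-monic (IsMonic-^ₚ p° m) (begin
          (u *ₚ p) *ₚ (p ^ₚ m)   ≈⟨ *ₚ-assoc u p (p ^ₚ m) ⟩
          u *ₚ (p ^ₚ suc m)      ≈⟨ upᵐ⁺¹≈f ⟩
          f                      ≈⟨ ≈-sym tpᵐ≈f ⟩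
          t *ₚ (p ^ₚ m)          ∎)))
    where open ≈-Reasoning

  Valuation-unique : ∀ {d p f m m′} → IsMonic d p → Valuation p f m → Valuation p f m′ → m ≡ m′
  Valuation-unique p° v v′ =
    ℕ.≤-antisym (∣⇒≤Valuation p° v′ (Valuation⇒∣ v ℕ.≤-refl)) (∣⇒≤Valuation p° v (Valuation⇒∣ v′ ℕ.≤-refl))

  valuation-exists : ∀ {d p n f} → IsIrreducible d p → IsMonic n f → Σ ℕ (Valuation p f)
  valuation-exists {d} {p} {n} p° = <-rec _ step n
    where
      p-monic = monic p°
      step : ∀ n → (∀ {k} → k < n → ∀ {f} → IsMonic k f → Σ ℕ (Valuation p f)) →
             ∀ {f} → IsMonic n f → Σ ℕ (Valuation p f)
      step n rec {f} f° with p-monic ∣? f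
      ... | no  p∤f = 0 , ∤⇒Valuation-0 p∤f
      ... | yes (t , tp≈f) with monic-cofactor p-monic f° (t , tp≈f)
      ...   | e , e+d≡n , t° with rec (ℕ.<-≤-trans (ℕ.m<m+n e (positive p°)) (ℕ.≤-reflexive e+d≡n)) t°
      ...     | m , valuation u upᵐ≈t p∤u = suc m , valuation u upᵐ⁺¹≈f p∤u
        where
          open ≈-Reasoning
          upᵐ⁺¹≈f : u *ₚ (p ^ₚ suc m) ≈ f
          upᵐ⁺¹≈f = begin
            u *ₚ (p *ₚ (p ^ₚ m))  ≈⟨ *ₚ-congˡ u (*ₚ-comm p (p ^ₚ m)) ⟩
            u *ₚ ((p ^ₚ m) *ₚ p)  ≈⟨ ≈-sym (*ₚ-assoc u (p ^ₚ m) p) ⟩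
            (u *ₚ (p ^ₚ m)) *ₚ p  ≈⟨ *ₚ-congʳ p upᵐ≈t ⟩
            t *ₚ p                ≈⟨ tp≈f ⟩
            f                     ∎

  Valuation-*ₚ : ∀ {d p f g m m′} → IsIrreducible d p →
                 Valuation p f m → Valuation p g m′ → Valuation p (f *ₚ g) (m ℕ.+ m′)
  Valuation-*ₚ {p = p} {f} {g} {m} {m′} p° (valuation t tpᵐ≈f p∤t) (valuation u upᵐ′≈g p∤u) =
    valuation (t *ₚ u) tupᵐ⁺ᵐ′≈fg p∤tu
    where
      open ≈-Reasoning
      tupᵐ⁺ᵐ′≈fg : (t *ₚ u) *ₚ (p ^ₚ (m ℕ.+ m′)) ≈ f *ₚ g
      tupᵐ⁺ᵐ′≈fg = begin
        (t *ₚ u) *ₚ (p ^ₚ (m ℕ.+ m′))            ≈⟨ *ₚ-congˡ (t *ₚ u) (^ₚ-homo-*ₚ p m m′) ⟩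
        (t *ₚ u) *ₚ ((p ^ₚ m) *ₚ (p ^ₚ m′))      ≈⟨ interchange t u (p ^ₚ m) (p ^ₚ m′) ⟩
        (t *ₚ (p ^ₚ m)) *ₚ (u *ₚ (p ^ₚ m′))      ≈⟨ *ₚ-cong tpᵐ≈f upᵐ′≈g ⟩
        f *ₚ g                                   ∎
      p∤tu : p ∤ (t *ₚ u)
      p∤tu p∣tu with euclid p° p∣tu
      ... | inj₁ p∣t = p∤t p∣t
      ... | inj₂ p∣u = p∤u p∣u

  Valuation-1ₚ : ∀ {d p} → IsIrreducible d p → Valuation p 1ₚ 0
  Valuation-1ₚ p° = ∤⇒Valuation-0 (positive-degree-∤1ₚ (monic p°) (positive p°))

  Valuation-^ₚ : ∀ {d p f m} → IsIrreducible d p → Valuation p f m → ∀ a → Valuation p (f ^ₚ a) (a ℕ.* m)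
  Valuation-^ₚ p° v zero    = Valuation-1ₚ p°
  Valuation-^ₚ p° v (suc a) = Valuation-*ₚ p° v (Valuation-^ₚ p° v a)

  Valuation-self : ∀ {d p} → IsIrreducible d p → Valuation p p 1
  Valuation-self {p = p} p° = valuation 1ₚ (≈-trans (*ₚ-identityˡ (p ^ₚ 1)) (^ₚ-1 p)) (Valuation.∤cofactor (Valuation-1ₚ p°))

module Enumeration {q : ℕ} (F : FiniteField q) where
  open FiniteField F
  open Inverse card using (to; from; strictlyInverseˡ; strictlyInverseʳ)
  open Poly F using (Monic)

  elements : List Carrier
  elements = tabulate from

  elements-unique : Unique elements
  elements-unique = Unique.tabulate⁺ λ {i} {j} fromᵢ≡fromⱼ →
    trans (sym (strictlyInverseˡ i)) (trans (cong to fromᵢ≡fromⱼ) (strictlyInverseˡ j))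

  ∈-elements : ∀ c → c ∈ elements
  ∈-elements c = subst (_∈ elements) (strictlyInverseʳ c) (∈-tabulate⁺ (to c))

  length-elements : length elements ≡ q
  length-elements = length-tabulate from

  monics : (k : ℕ) → List (Monic k)
  monics zero    = [ Vec.[] ]
  monics (suc k) = cartesianProductWith Vec._∷_ elements (monics k)

  monics-unique : ∀ k → Unique (monics k)
  monics-unique zero    = All.[] AllPairs.∷ AllPairs.[]
  monics-unique (suc k) = Unique.cartesianProductWith⁺ Vec._∷_ Vec.∷-injective elements-unique (monics-unique k)

  ∈-monics : ∀ {k} (v : Monic k) → v ∈ monics k
  ∈-monics Vec.[]       = here refl
  ∈-monics (x Vec.∷ v) = ∈-cartesianProductWith⁺ Vec._∷_ (∈-elements x) (∈-monics v)

  length-monics : ∀ k → length (monics k) ≡ q ^ k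
  length-monics zero    = refl
  length-monics (suc k) =
    trans (length-cartesianProductWith Vec._∷_ elements (monics k)) (cong₂ ℕ._*_ length-elements (length-monics k))

module Factorisation {q : ℕ} (F : FiniteField q) where
  open FiniteField F
  open PolynomialRing F
  open Degree F
  open Division F
  open Valuations F
  open Enumeration F

  HasMonicDivisorOfDegree : Pol → ℕ → Set
  HasMonicDivisorOfDegree f k = 0 < k × Any (λ r → toPol r ∣ f) (monics k)

  hasMonicDivisorOfDegree? : ∀ f k → Dec (HasMonicDivisorOfDegree f k)
  hasMonicDivisorOfDegree? f k = (0 ℕ.<? k) ×-dec Any.any? (λ r → IsMonic-toPol r ∣? f) (monics k)

  irreducible-factor : ∀ n {f} → IsMonic n f → 0 < n → Σ ℕ λ d → Σ Pol λ p → IsIrreducible d p × p ∣ f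
  irreducible-factor = <-rec _ step
    where
      step : ∀ n → (∀ {k} → k < n → ∀ {f} → IsMonic k f → 0 < k → Σ ℕ λ d → Σ Pol λ p → IsIrreducible d p × p ∣ f) →
             ∀ {f} → IsMonic n f → 0 < n → Σ ℕ λ d → Σ Pol λ p → IsIrreducible d p × p ∣ f
      step n rec {f} f° 0<n with ℕ.anyUpTo? (hasMonicDivisorOfDegree? f) n
      ... | yes (k , k<n , 0<k , r∣f-somewhere) with Any.satisfied r∣f-somewhere
      ...   | r , r∣f with rec k<n (IsMonic-toPol r) 0<k
      ...     | d , p , p° , p∣r = d , p , p° , ∣ʳ-trans p∣r r∣f
      step n rec {f} f° 0<n | no no-proper-divisor =
        n , f , record { monic = f° ; positive = 0<n ; divisors = divisors-f } , ∣ʳ-refl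
        where
          divisors-f : ∀ {k r} → IsMonic k r → r ∣ f → k ≡ 0 ⊎ k ≡ n
          divisors-f {k} {r} r° r∣f with monic-cofactor r° f° r∣f
          ... | e , e+k≡n , _ with k ℕ.≟ 0 | e ℕ.≟ 0
          ...   | yes k≡0 | _        = inj₁ k≡0
          ...   | no _    | yes refl = inj₂ e+k≡n
          ...   | no k≢0  | no e≢0   = ⊥-elim (no-proper-divisor (k , k<n , ℕ.n≢0⇒n>0 k≢0 , r′∣f-somewhere))
            where
              k<n : k < n
              k<n = ℕ.<-≤-trans (ℕ.m<n+m k (ℕ.n≢0⇒n>0 e≢0)) (ℕ.≤-reflexive e+k≡n)
              r′∣f-somewhere : Any (λ r′ → toPol r′ ∣ f) (monics k)
              r′∣f-somewhere = lose (∈-monics (fromPol k r)) (∣ʳ-respˡ-≈ (≈-sym (toPol-fromPol k r°)) r∣f)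

  irreducible-factor-with-positive-valuation : ∀ n {f} → IsMonic n f → 0 < n →
    Σ ℕ λ d → Σ Pol λ p → Σ ℕ λ m → IsIrreducible d p × Valuation p f m × 0 < m
  irreducible-factor-with-positive-valuation n f° 0<n with irreducible-factor n f° 0<n
  ... | d , p , p° , p∣f with valuation-exists p° f°
  ...   | m , v = d , p , m , p° , v , ∣⇒≤Valuation (monic p°) v (∣ʳ-respˡ-≈ (≈-sym (^ₚ-1 p)) p∣f)

  irreducible-∣-irreducible : ∀ {d e p r} → IsIrreducible d p → IsIrreducible e r → r ∣ p → r ≈ p
  irreducible-∣-irreducible {d} {e} {p} {r} p° r° r∣p@(t , tr≈p) with divisors p° (monic r°) r∣p
  ... | inj₁ refl = ⊥-elim (ℕ.<-irrefl refl (positive r°))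
  ... | inj₂ refl with monic-cofactor (monic r°) (monic p°) r∣p
  ...   | e′ , e′+d≡d , t° with ℕ.+-cancelʳ-≡ d e′ 0 e′+d≡d
  ...     | refl = ≈-trans (≈-sym (*ₚ-identityˡ r)) (≈-trans (*ₚ-congʳ r (≈-sym (IsMonic-0⇒≈1ₚ t°))) tr≈p)

  Valuation-irreducible : ∀ {d e p r} → IsIrreducible d p → IsIrreducible e r → r ≈ p ⊎ Valuation r p 0
  Valuation-irreducible p° r° with monic r° ∣? _
  ... | yes r∣p = inj₁ (irreducible-∣-irreducible p° r° r∣p)
  ... | no  r∤p = inj₂ (∤⇒Valuation-0 r∤p)

  SameValuations : Pol → Pol → Set
  SameValuations f g = ∀ {d p m m′} → IsIrreducible d p → Valuation p f m → Valuation p g m′ → m ≡ m′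

  ≈-from-valuations : ∀ n {n′ f g} → IsMonic n f → IsMonic n′ g → SameValuations f g → f ≈ g
  ≈-from-valuations = <-rec _ step
    where
      step : ∀ n → (∀ {k} → k < n → ∀ {n′ f g} → IsMonic k f → IsMonic n′ g → SameValuations f g → f ≈ g) →
             ∀ {n′ f g} → IsMonic n f → IsMonic n′ g → SameValuations f g → f ≈ g
      step zero    _   {zero}   f° g° _    = ≈-trans (IsMonic-0⇒≈1ₚ f°) (≈-sym (IsMonic-0⇒≈1ₚ g°))
      step zero    _   {suc n′} f° g° same with irreducible-factor-with-positive-valuation (suc n′) g° (s≤s z≤n)
      ... | d , p , m , p° , v , 0<m =
            ⊥-elim (ℕ.<-irrefl (same p° (Valuation-resp-≈ (≈-sym (IsMonic-0⇒≈1ₚ f°)) (Valuation-1ₚ p°)) v) 0<m)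
      step (suc n) rec {n′} {f} {g} f° g° same with irreducible-factor-with-positive-valuation (suc n) f° (s≤s z≤n)
      ... | d , p , m , p° , vf , 0<m with valuation-exists p° g°
      ...   | m′ , vg with same p° vf vg
      ...     | refl with ∣ʳ-respˡ-≈ (^ₚ-1 p) (Valuation⇒∣ vf 0<m) | ∣ʳ-respˡ-≈ (^ₚ-1 p) (Valuation⇒∣ vg 0<m)
      ...       | p∣f@(f₁ , f₁p≈f) | p∣g@(g₁ , g₁p≈g)
                  with monic-cofactor (monic p°) f° p∣f | monic-cofactor (monic p°) g° p∣g
      ...         | e , e+d≡1+n , f₁° | _ , _ , g₁° =
                    ≈-trans (≈-sym f₁p≈f) (≈-trans (*ₚ-congʳ p (rec e<1+n f₁° g₁° same₁)) g₁p≈g)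
        where
          e<1+n : e < suc n
          e<1+n = ℕ.<-≤-trans (ℕ.m<m+n e (positive p°)) (ℕ.≤-reflexive e+d≡1+n)
          same₁ : SameValuations f₁ g₁
          same₁ r° vf₁ vg₁ with valuation-exists r° (monic p°)
          ... | x , vp = ℕ.+-cancelʳ-≡ x _ _
                (same r° (Valuation-resp-≈ f₁p≈f (Valuation-*ₚ r° vf₁ vp)) (Valuation-resp-≈ g₁p≈g (Valuation-*ₚ r° vg₁ vp)))

module MonicPolynomials {q : ℕ} (F : FiniteField q) where
  open FiniteField F
  open PolynomialRing F
  open Degree F
  open Division F
  open Valuations F

  length-*ₚ-exact : ∀ {d e} f g → length f ≡ suc d → length g ≡ suc e → length (f *ₚ g) ≡ suc (d ℕ.+ e)
  length-*ₚ-exact (a ∷ f) (b ∷ g) |f|≡1+d |g|≡1+e =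
    trans (length-*ₚ a f b g) (cong suc (cong₂ ℕ._+_ (ℕ.suc-injective |f|≡1+d) (ℕ.suc-injective |g|≡1+e)))

  length-^ₚ-exact : ∀ {d} f → length f ≡ suc d → ∀ m → length (f ^ₚ m) ≡ suc (m ℕ.* d)
  length-^ₚ-exact f |f|≡1+d zero    = refl
  length-^ₚ-exact f |f|≡1+d (suc m) = length-*ₚ-exact f (f ^ₚ m) |f|≡1+d (length-^ₚ-exact f |f|≡1+d m)

  ∣ₚ⇒∣ : ∀ {g f} → g ∣ₚ f → g ∣ f
  ∣ₚ⇒∣ {g} (_ , h , g*h≡f) = toPol h , ≈-trans (*ₚ-comm (toPol h) g) (≡⇒≈ g*h≡f)

  ∣⇒∣ₚ : ∀ {d n g} → IsMonic d g → length g ≡ suc d → (f : Monic n) → g ∣ toPol f → g ∣ₚ toPol f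
  ∣⇒∣ₚ {d} {n} {g} g° |g|≡1+d f g∣f@(t , tg≈f) with monic-cofactor g° (IsMonic-toPol f) g∣f
  ... | e , e+d≡n , t° = e , fromPol e t , ≈∧length⇒≡ g*h≈f |g*h|≡|f|
    where
      g*h≈f : g *ₚ toPol (fromPol e t) ≈ toPol f
      g*h≈f = ≈-trans (*ₚ-congˡ g (toPol-fromPol e t°)) (≈-trans (*ₚ-comm g t) tg≈f)
      |g*h|≡1+d+e : length (g *ₚ toPol (fromPol e t)) ≡ suc (d ℕ.+ e)
      |g*h|≡1+d+e = length-*ₚ-exact g _ |g|≡1+d (length-toPol (fromPol e t))
      |g*h|≡|f| : length (g *ₚ toPol (fromPol e t)) ≡ length (toPol f)
      |g*h|≡|f| = trans |g*h|≡1+d+e (trans (cong suc (trans (ℕ.+-comm d e) e+d≡n)) (sym (length-toPol f)))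

  toPol-^ₚ-∣⇒∣ₚ : ∀ {d n} (p : Monic d) m (f : Monic n) → toPol p ^ₚ m ∣ toPol f → (toPol p ^ₚ m) ∣ₚ toPol f
  toPol-^ₚ-∣⇒∣ₚ p m = ∣⇒∣ₚ (IsMonic-^ₚ (IsMonic-toPol p) m) (length-^ₚ-exact (toPol p) (length-toPol p) m)

  Multiplicity⇒Valuation : ∀ {d n m} (p : Monic d) (f : Monic n) → IsIrreducible d (toPol p) →
                           Multiplicity p f m → Valuation (toPol p) (toPol f) m
  Multiplicity⇒Valuation {m = m} p f p° (pᵐ∣f , pᵐ⁺¹∤f) with valuation-exists p° (IsMonic-toPol f)
  ... | m′ , v = subst (Valuation (toPol p) (toPol f)) (sym m≡m′) v
    where
      m′≤m : m′ ≤ m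
      m′≤m with ℕ.≤-<-connex m′ m
      ... | inj₁ m′≤m = m′≤m
      ... | inj₂ m<m′ = ⊥-elim (pᵐ⁺¹∤f (toPol-^ₚ-∣⇒∣ₚ p (suc m) f (Valuation⇒∣ v m<m′)))
      m≡m′ : m ≡ m′
      m≡m′ = ℕ.≤-antisym (∣⇒≤Valuation (monic p°) v (∣ₚ⇒∣ pᵐ∣f)) m′≤m

  Valuation⇒Multiplicity : ∀ {d n m} (p : Monic d) (f : Monic n) → IsIrreducible d (toPol p) →
                           Valuation (toPol p) (toPol f) m → Multiplicity p f m
  Valuation⇒Multiplicity {m = m} p f p° v =
    toPol-^ₚ-∣⇒∣ₚ p m f (Valuation⇒∣ v ℕ.≤-refl) ,
    λ pᵐ⁺¹∣f → ℕ.<-irrefl refl (∣⇒≤Valuation (monic p°) v (∣ₚ⇒∣ pᵐ⁺¹∣f))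

  Irreducible⇒IsIrreducible : ∀ {d} (p : Monic d) → Irreducible p → IsIrreducible d (toPol p)
  Irreducible⇒IsIrreducible {d} p (0<d , irreducible) =
    record { monic = IsMonic-toPol p ; positive = 0<d ; divisors = divisors-p }
    where
      divisors-p : ∀ {k r} → IsMonic k r → r ∣ toPol p → k ≡ 0 ⊎ k ≡ d
      divisors-p {k} {r} r° r∣p@(t , tr≈p) with monic-cofactor r° (IsMonic-toPol p) r∣p
      ... | e , e+k≡d , t° with irreducible k e (fromPol k r) (fromPol e t) (≈∧length⇒≡ u*w≈p |u*w|≡|p|)
        where
          u*w≈p : toPol (fromPol k r) *ₚ toPol (fromPol e t) ≈ toPol p
          u*w≈p = ≈-trans (*ₚ-cong (toPol-fromPol k r°) (toPol-fromPol e t°)) (≈-trans (*ₚ-comm r t) tr≈p)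
          |u*w|≡|p| : length (toPol (fromPol k r) *ₚ toPol (fromPol e t)) ≡ length (toPol p)
          |u*w|≡|p| = trans (length-*ₚ-exact (toPol (fromPol k r)) (toPol (fromPol e t))
                                              (length-toPol (fromPol k r)) (length-toPol (fromPol e t)))
                            (trans (cong suc (trans (ℕ.+-comm k e) e+k≡d)) (sym (length-toPol p)))
      ...   | inj₁ k≡0    = inj₁ k≡0
      ...   | inj₂ refl   = inj₂ e+k≡d

  IsIrreducible⇒Irreducible : ∀ {d} (p : Monic d) → IsIrreducible d (toPol p) → Irreducible p
  IsIrreducible⇒Irreducible {d} p p° = positive p° , irreducible
    where
      irreducible : ∀ d₁ d₂ (u : Monic d₁) (w : Monic d₂) → toPol u *ₚ toPol w ≡ toPol p → d₁ ≡ 0 ⊎ d₂ ≡ 0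
      irreducible d₁ d₂ u w u*w≡p
        with divisors p° (IsMonic-toPol u) (toPol w , ≈-trans (*ₚ-comm (toPol w) (toPol u)) (≡⇒≈ u*w≡p))
      ... | inj₁ d₁≡0 = inj₁ d₁≡0
      ... | inj₂ refl = inj₂ (ℕ.+-cancelˡ-≡ d₁ d₂ 0 (trans d₁+d₂≡d₁ (sym (ℕ.+-identityʳ d₁))))
        where
          d₁+d₂≡d₁ : d₁ ℕ.+ d₂ ≡ d₁
          d₁+d₂≡d₁ = monic-degree-unique
            (HasDegree-resp-≈ (≡⇒≈ u*w≡p) (IsMonic-*ₚ (IsMonic-toPol u) (IsMonic-toPol w))) (monic p°)

module PowerFree {q : ℕ} (F : FiniteField q) (a : ℕ) (0<a : 0 < a) where
  open FiniteField F
  open PolynomialRing F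
  open Degree F
  open Division F
  open Valuations F
  open Factorisation F
  open Enumeration F

  IsPowerFree : Pol → Set
  IsPowerFree h = ∀ {d p m} → IsIrreducible d p → Valuation p h m → m < a

  IsPowerFree-resp-≈ : ∀ {h h′} → h ≈ h′ → IsPowerFree h → IsPowerFree h′
  IsPowerFree-resp-≈ h≈h′ free p° v = free p° (Valuation-resp-≈ (≈-sym h≈h′) v)

  IsPowerFree-1ₚ : IsPowerFree 1ₚ
  IsPowerFree-1ₚ p° v = subst (_< a) (Valuation-unique (monic p°) (Valuation-1ₚ p°) v) 0<a

  IsPowerFree-*ₚ-^ₚ : ∀ {d p k h j} → IsIrreducible d p → j < a → IsMonic k h → IsPowerFree h → p ∤ h →
                      IsPowerFree (h *ₚ (p ^ₚ j))
  IsPowerFree-*ₚ-^ₚ {p = p} {h = h} {j = j} p° j<a h° free p∤h {p = r} {m = y} r° v with Valuation-irreducible p° r°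
  ... | inj₁ r≈p = subst (_< a) (Valuation-unique (monic r°) vᵣ v) (subst (_< a) (sym (ℕ.*-identityʳ j)) j<a)
    where
      vᵣ : Valuation r (h *ₚ (p ^ₚ j)) (0 ℕ.+ j ℕ.* 1)
      vᵣ = Valuation-respₚ-≈ (≈-sym r≈p) (Valuation-*ₚ p° (∤⇒Valuation-0 p∤h) (Valuation-^ₚ p° (Valuation-self p°) j))
  ... | inj₂ vᵣp with valuation-exists r° h°
  ...   | y₁ , vᵣh = subst (_< a) (Valuation-unique (monic r°) (Valuation-*ₚ r° vᵣh (Valuation-^ₚ r° vᵣp j)) v)
                       (subst (_< a) (sym (trans (cong (y₁ ℕ.+_) (ℕ.*-zeroʳ j)) (ℕ.+-identityʳ y₁))) (free r° vᵣh))

  HasPowerDivisorOfDegree : Pol → ℕ → Set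
  HasPowerDivisorOfDegree h d = 0 < d × Any (λ r → toPol r ^ₚ a ∣ h) (monics d)

  -- A decidable form of IsPowerFree (toPol h): only the finitely many monic r of degree ≤ k can have
  -- r ^ a dividing h.
  IsPowerFreeMonic : ∀ {k} → Monic k → Set
  IsPowerFreeMonic {k} h = ¬ (Σ ℕ λ d → d < suc k × HasPowerDivisorOfDegree (toPol h) d)

  isPowerFreeMonic? : ∀ {k} (h : Monic k) → Dec (IsPowerFreeMonic h)
  isPowerFreeMonic? {k} h = ¬? (ℕ.anyUpTo? hasPowerDivisorOfDegree? (suc k))
    where
      hasPowerDivisorOfDegree? : ∀ d → Dec (HasPowerDivisorOfDegree (toPol h) d)
      hasPowerDivisorOfDegree? d = (0 ℕ.<? d) ×-dec Any.any? (λ r → IsMonic-^ₚ (IsMonic-toPol r) a ∣? toPol h) (monics d)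

  IsPowerFreeMonic⇒IsPowerFree : ∀ {k} (h : Monic k) → IsPowerFreeMonic h → IsPowerFree (toPol h)
  IsPowerFreeMonic⇒IsPowerFree {k} h no-power-divisor {d} {p} {m} p° v with ℕ.≤-<-connex a m
  ... | inj₂ m<a = m<a
  ... | inj₁ a≤m with monic-cofactor (monic p°) (IsMonic-toPol h) (∣ʳ-trans (∣⇒∣-^ₚ a 0<a ∣ʳ-refl) pᵃ∣h)
    where pᵃ∣h = Valuation⇒∣ v a≤m
  ...   | e , e+d≡k , _ = ⊥-elim (no-power-divisor (d , s≤s d≤k , positive p° , rᵃ∣h-somewhere))
    where
      d≤k : d ≤ k
      d≤k = ℕ.≤-trans (ℕ.m≤n+m d e) (ℕ.≤-reflexive e+d≡k)
      rᵃ∣h-somewhere : Any (λ r → toPol r ^ₚ a ∣ toPol h) (monics d)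
      rᵃ∣h-somewhere = lose (∈-monics (fromPol d p))
        (∣ʳ-respˡ-≈ (^ₚ-congˡ a (≈-sym (toPol-fromPol d (monic p°)))) (Valuation⇒∣ v a≤m))

  IsPowerFree⇒IsPowerFreeMonic : ∀ {k} (h : Monic k) → IsPowerFree (toPol h) → IsPowerFreeMonic h
  IsPowerFree⇒IsPowerFreeMonic h free (d , _ , 0<d , rᵃ∣h-somewhere) with Any.satisfied rᵃ∣h-somewhere
  ... | r , rᵃ∣h with irreducible-factor d (IsMonic-toPol r) 0<d
  ...   | _ , p , p° , p∣r with valuation-exists p° (IsMonic-toPol h)
  ...     | m , v = ℕ.<⇒≱ (free p° v) (∣⇒≤Valuation (monic p°) v (∣ʳ-trans (∣-^ₚ a p∣r) rᵃ∣h))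

  powerFrees : (k : ℕ) → List (Monic k)
  powerFrees k = filter isPowerFreeMonic? (monics k)

  powerFreeCount : ℕ → ℕ
  powerFreeCount k = length (powerFrees k)

  powerFrees-unique : ∀ k → Unique (powerFrees k)
  powerFrees-unique k = Unique.filter⁺ isPowerFreeMonic? (monics-unique k)

module Decomposition {q : ℕ} (F : FiniteField q) (a b : ℕ) (0<a : 0 < a) (0<b : 0 < b) (coprime : Coprime a b) where
  open FiniteField F
  open PolynomialRing F
  open Degree F
  open Division F
  open Valuations F
  open Factorisation F
  open PowerFree F a 0<a
  open CommutativeSemigroupProperties (CommutativeRing.*-commutativeSemigroup ℙ) using (interchange)

  IsGood : Pol → Set
  IsGood f = ∀ {d p m} → IsIrreducible d p → Valuation p f m → InM a b m

  IsGood-resp-≈ : ∀ {f f′} → f ≈ f′ → IsGood f → IsGood f′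
  IsGood-resp-≈ f≈f′ good p° v = good p° (Valuation-resp-≈ (≈-sym f≈f′) v)

  Valuation-^a*^b : ∀ {d p g h x z} → IsIrreducible d p → Valuation p g x → Valuation p h z →
                    Valuation p ((g ^ₚ a) *ₚ (h ^ₚ b)) (a ℕ.* x ℕ.+ b ℕ.* z)
  Valuation-^a*^b p° vg vh = Valuation-*ₚ p° (Valuation-^ₚ p° vg a) (Valuation-^ₚ p° vh b)

  IsGood-^a*^b : ∀ {i k g h} → IsMonic i g → IsMonic k h → IsGood ((g ^ₚ a) *ₚ (h ^ₚ b))
  IsGood-^a*^b g° h° p° v with valuation-exists p° g° | valuation-exists p° h°
  ... | x , vg | z , vh = x , z , Valuation-unique (monic p°) (Valuation-^a*^b p° vg vh) v

  IsGood-cofactor : ∀ {d p f m} → IsIrreducible d p → IsGood f → (v : Valuation p f m) → IsGood (cofactor v)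
  IsGood-cofactor {p = p} {m = m} p° good (valuation f₁ f₁pᵐ≈f p∤f₁) {m = y} r° v₁ with Valuation-irreducible p° r°
  ... | inj₁ r≈p = subst (InM a b) (Valuation-unique (monic r°) (∤⇒Valuation-0 r∤f₁) v₁) (InM-0 a b)
    where r∤f₁ = λ r∣f₁ → p∤f₁ (∣ʳ-respˡ-≈ r≈p r∣f₁)
  ... | inj₂ vᵣp = subst (InM a b) (trans (cong (y ℕ.+_) (ℕ.*-zeroʳ m)) (ℕ.+-identityʳ y))
                     (good r° (Valuation-resp-≈ f₁pᵐ≈f (Valuation-*ₚ r° v₁ (Valuation-^ₚ r° vᵣp m))))

  record Decomposition (f : Pol) : Set where
    constructor decomposition
    field i k         : ℕ
          g h         : Pol
          g-monic     : IsMonic i g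
          h-monic     : IsMonic k h
          h-powerFree : IsPowerFree h
          ≈-f         : (g ^ₚ a) *ₚ (h ^ₚ b) ≈ f

  ^a*^b-absorb : ∀ g h p i j → ((g *ₚ (p ^ₚ i)) ^ₚ a) *ₚ ((h *ₚ (p ^ₚ j)) ^ₚ b) ≈
                                ((g ^ₚ a) *ₚ (h ^ₚ b)) *ₚ (p ^ₚ (a ℕ.* i ℕ.+ b ℕ.* j))
  ^a*^b-absorb g h p i j = begin
    ((g *ₚ (p ^ₚ i)) ^ₚ a) *ₚ ((h *ₚ (p ^ₚ j)) ^ₚ b)
      ≈⟨ *ₚ-cong (^ₚ-distrib-*ₚ-^ₚ g p i a) (^ₚ-distrib-*ₚ-^ₚ h p j b) ⟩
    ((g ^ₚ a) *ₚ (p ^ₚ (a ℕ.* i))) *ₚ ((h ^ₚ b) *ₚ (p ^ₚ (b ℕ.* j)))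
      ≈⟨ interchange (g ^ₚ a) (p ^ₚ (a ℕ.* i)) (h ^ₚ b) (p ^ₚ (b ℕ.* j)) ⟩
    ((g ^ₚ a) *ₚ (h ^ₚ b)) *ₚ ((p ^ₚ (a ℕ.* i)) *ₚ (p ^ₚ (b ℕ.* j)))
      ≈⟨ *ₚ-congˡ ((g ^ₚ a) *ₚ (h ^ₚ b)) (≈-sym (^ₚ-homo-*ₚ p (a ℕ.* i) (b ℕ.* j))) ⟩
    ((g ^ₚ a) *ₚ (h ^ₚ b)) *ₚ (p ^ₚ (a ℕ.* i ℕ.+ b ℕ.* j))
      ∎
    where open ≈-Reasoning

  decompose : ∀ n {f} → IsMonic n f → IsGood f → Decomposition f
  decompose = <-rec _ step
    where
      step : ∀ n → (∀ {n₁} → n₁ < n → ∀ {f} → IsMonic n₁ f → IsGood f → Decomposition f) →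
             ∀ {f} → IsMonic n f → IsGood f → Decomposition f
      step zero    _   f° _ = decomposition 0 0 1ₚ 1ₚ IsMonic-1ₚ IsMonic-1ₚ IsPowerFree-1ₚ
        (≈-trans (*ₚ-cong (1ₚ-^ₚ a) (1ₚ-^ₚ b)) (≈-trans (*ₚ-identityˡ 1ₚ) (≈-sym (IsMonic-0⇒≈1ₚ f°))))
      step (suc n) rec {f} f° good with irreducible-factor-with-positive-valuation (suc n) f° (s≤s z≤n)
      ... | d , p , m , p° , v@(valuation f₁ f₁pᵐ≈f p∤f₁) , 0<m with InM-normalForm {b = b} 0<a (good p° v)
      ... | i , j , ai+bj≡m , j<a with monic-cofactor (IsMonic-^ₚ (monic p°) m) f° (f₁ , f₁pᵐ≈f)
      ... | n₁ , n₁+md≡1+n , f₁° with rec n₁<1+n f₁° (IsGood-cofactor p° good v)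
        where
          n₁<1+n : n₁ < suc n
          n₁<1+n = ℕ.<-≤-trans (ℕ.m<m+n n₁ (ℕ.*-mono-≤ 0<m (positive p°))) (ℕ.≤-reflexive n₁+md≡1+n)
      ... | decomposition i₁ k₁ g₁ h₁ g₁° h₁° free₁ g₁ᵃh₁ᵇ≈f₁ =
            decomposition (i₁ ℕ.+ i ℕ.* d) (k₁ ℕ.+ j ℕ.* d) (g₁ *ₚ (p ^ₚ i)) (h₁ *ₚ (p ^ₚ j))
              (IsMonic-*ₚ g₁° (IsMonic-^ₚ (monic p°) i)) (IsMonic-*ₚ h₁° (IsMonic-^ₚ (monic p°) j))
              (IsPowerFree-*ₚ-^ₚ p° j<a h₁° free₁ p∤h₁) gᵃhᵇ≈f
        where
          p∤h₁ : p ∤ h₁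
          p∤h₁ p∣h₁ = p∤f₁ (∣ʳ-respʳ-≈ g₁ᵃh₁ᵇ≈f₁ (x∣ʳy⇒x∣ʳzy (g₁ ^ₚ a) (∣⇒∣-^ₚ b 0<b p∣h₁)))
          gᵃhᵇ≈f : ((g₁ *ₚ (p ^ₚ i)) ^ₚ a) *ₚ ((h₁ *ₚ (p ^ₚ j)) ^ₚ b) ≈ f
          gᵃhᵇ≈f = ≈-trans (^a*^b-absorb g₁ h₁ p i j)
                           (≈-trans (*ₚ-cong g₁ᵃh₁ᵇ≈f₁ (≡⇒≈ (cong (p ^ₚ_) ai+bj≡m))) f₁pᵐ≈f)

  decomposition-unique : ∀ {i k i′ k′ g h g′ h′} → IsMonic i g → IsMonic k h → IsMonic i′ g′ → IsMonic k′ h′ →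
    IsPowerFree h → IsPowerFree h′ → (g ^ₚ a) *ₚ (h ^ₚ b) ≈ (g′ ^ₚ a) *ₚ (h′ ^ₚ b) → g ≈ g′ × h ≈ h′
  decomposition-unique {i} {k} {g = g} {h} {g′} {h′} g° h° g′° h′° free free′ gᵃhᵇ≈g′ᵃh′ᵇ =
    ≈-from-valuations i g° g′° same-g , ≈-from-valuations k h° h′° same-h
    where
      same-exponents : ∀ {d p x z x′ z′} → IsIrreducible d p → Valuation p g x → Valuation p h z →
                       Valuation p g′ x′ → Valuation p h′ z′ → x ≡ x′ × z ≡ z′
      same-exponents p° vg vh vg′ vh′ = normalForm-unique coprime (free p° vh) (free′ p° vh′)
        (Valuation-unique (monic p°) (Valuation-resp-≈ gᵃhᵇ≈g′ᵃh′ᵇ (Valuation-^a*^b p° vg vh)) (Valuation-^a*^b p° vg′ vh′))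
      same-g : SameValuations g g′
      same-g p° vg vg′ =
        proj₁ (same-exponents p° vg (proj₂ (valuation-exists p° h°)) vg′ (proj₂ (valuation-exists p° h′°)))
      same-h : SameValuations h h′
      same-h p° vh vh′ =
        proj₂ (same-exponents p° (proj₂ (valuation-exists p° g°)) vh (proj₂ (valuation-exists p° g′°)) vh′)

module Counting {q : ℕ} (F : FiniteField q) (a b : ℕ) (0<a : 0 < a) (0<b : 0 < b) (coprime : Coprime a b) where
  open FiniteField F
  open PolynomialRing F
  open Degree F
  open Division F
  open Valuations F
  open Enumeration F
  open MonicPolynomials F
  open PowerFree F a 0<a
  open Decomposition F a b 0<a 0<b coprime

  Good⇒IsGood : ∀ {n} (f : Monic n) → Good F a b f → IsGood (toPol f)
  Good⇒IsGood f good {d} {p′} {m} p′° v with m ℕ.≟ 0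
  ... | yes refl = InM-0 a b
  ... | no  m≢0  = subst (InM a b) (Valuation-unique (monic p′°) vₚ v) (proj₂ (proj₂ G))
    where
      p = fromPol d p′
      p≈p′ : toPol p ≈ p′
      p≈p′ = toPol-fromPol d (monic p′°)
      p° : IsIrreducible d (toPol p)
      p° = IsIrreducible-resp-≈ (≈-sym p≈p′) p′°
      p∣f : toPol p ∣ toPol f
      p∣f = ∣ʳ-respˡ-≈ (≈-trans (^ₚ-1 p′) (≈-sym p≈p′)) (Valuation⇒∣ v (ℕ.n≢0⇒n>0 m≢0))
      G = good d p (IsIrreducible⇒Irreducible p p°) (∣⇒∣ₚ (IsMonic-toPol p) (length-toPol p) f p∣f)
      vₚ : Valuation p′ (toPol f) (proj₁ G)
      vₚ = Valuation-respₚ-≈ p≈p′ (Multiplicity⇒Valuation p f p° (proj₁ (proj₂ G)))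

  IsGood⇒Good : ∀ {n} (f : Monic n) → IsGood (toPol f) → Good F a b f
  IsGood⇒Good f good d p irreducible _ with valuation-exists (Irreducible⇒IsIrreducible p irreducible) (IsMonic-toPol f)
  ... | m , v = m , Valuation⇒Multiplicity p f p° v , good p° v
    where p° = Irreducible⇒IsIrreducible p irreducible

  combine : ∀ n {i k} → Monic i → Monic k → Monic n
  combine n g h = fromPol n ((toPol g ^ₚ a) *ₚ (toPol h ^ₚ b))

  toPol-combine : ∀ {n i k} (g : Monic i) (h : Monic k) → a ℕ.* i ℕ.+ b ℕ.* k ≡ n →
                  toPol (combine n g h) ≈ (toPol g ^ₚ a) *ₚ (toPol h ^ₚ b)
  toPol-combine g h refl = toPol-fromPol _ (IsMonic-*ₚ (IsMonic-^ₚ (IsMonic-toPol g) a) (IsMonic-^ₚ (IsMonic-toPol h) b))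

  combine-injective : ∀ {n i k i′ k′} {g : Monic i} {h : Monic k} {g′ : Monic i′} {h′ : Monic k′} →
    a ℕ.* i ℕ.+ b ℕ.* k ≡ n → a ℕ.* i′ ℕ.+ b ℕ.* k′ ≡ n → IsPowerFreeMonic h → IsPowerFreeMonic h′ →
    combine n g h ≡ combine n g′ h′ → toPol g ≈ toPol g′ × toPol h ≈ toPol h′
  combine-injective {g = g} {h} {g′} {h′} e e′ free free′ eq =
    decomposition-unique (IsMonic-toPol g) (IsMonic-toPol h) (IsMonic-toPol g′) (IsMonic-toPol h′)
      (IsPowerFreeMonic⇒IsPowerFree h free) (IsPowerFreeMonic⇒IsPowerFree h′ free′)
      (≈-trans (≈-sym (toPol-combine g h e)) (≈-trans (≡⇒≈ (cong toPol eq)) (toPol-combine g′ h′ e′)))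

  combineAll : ∀ n {i} k → Monic i → List (Monic n)
  combineAll n k g = map (combine n g) (powerFrees k)

  goodsOfShape : ∀ n i k → List (Monic n)
  goodsOfShape n i k = if ⌊ a ℕ.* i ℕ.+ b ℕ.* k ℕ.≟ n ⌋
    then concatMap (combineAll n k) (monics i) else []

  goodsOfFirstDegree : ∀ n i → List (Monic n)
  goodsOfFirstDegree n i = concatMap (goodsOfShape n i) (upTo (suc n))

  -- Arranged like the double sum shapeSum, so that its length is computed term by term.
  goods : ∀ n → List (Monic n)
  goods n = concatMap (goodsOfFirstDegree n) (upTo (suc n))

  record Shape (n i k : ℕ) (f : Monic n) : Set where
    constructor shape
    field degrees     : a ℕ.* i ℕ.+ b ℕ.* k ≡ n
          g           : Monic i
          h           : Monic k
          h-powerFree : IsPowerFreeMonic h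
          f≡combine   : f ≡ combine n g h

  ∈-goodsOfShape⁻ : ∀ {n i k f} → f ∈ goodsOfShape n i k → Shape n i k f
  ∈-goodsOfShape⁻ {n} {i} {k} f∈ with ∈-if⁻ (a ℕ.* i ℕ.+ b ℕ.* k ℕ.≟ n) f∈
  ... | e , f∈′ with find (∈-concatMap⁻ (combineAll n k) {xs = monics i} f∈′)
  ...   | g , _ , f∈map with ∈-map⁻ (combine n g) f∈map
  ...     | h , h∈ , refl = shape e g h (proj₂ (∈-filter⁻ isPowerFreeMonic? {xs = monics k} h∈)) refl

  ∈-goodsOfFirstDegree⁻ : ∀ {n i f} → f ∈ goodsOfFirstDegree n i → Σ ℕ λ k → Shape n i k f
  ∈-goodsOfFirstDegree⁻ {n} {i} f∈ with find (∈-concatMap⁻ (goodsOfShape n i) {xs = upTo (suc n)} f∈)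
  ... | k , _ , f∈shape = k , ∈-goodsOfShape⁻ f∈shape

  ∈-goods⁻ : ∀ {n f} → f ∈ goods n → Σ ℕ λ i → Σ ℕ λ k → Shape n i k f
  ∈-goods⁻ {n} f∈ with find (∈-concatMap⁻ (goodsOfFirstDegree n) {xs = upTo (suc n)} f∈)
  ... | i , _ , f∈first = i , ∈-goodsOfFirstDegree⁻ f∈first

  Shape-unique : ∀ {n i k i′ k′ f} → Shape n i k f → Shape n i′ k′ f → i ≡ i′ × k ≡ k′
  Shape-unique (shape e g h free f≡gh) (shape e′ g′ h′ free′ f≡g′h′) =
    monic-degree-unique (IsMonic-toPol g) (HasDegree-resp-≈ (≈-sym (proj₁ g≈g′×h≈h′)) (IsMonic-toPol g′)) ,
    monic-degree-unique (IsMonic-toPol h) (HasDegree-resp-≈ (≈-sym (proj₂ g≈g′×h≈h′)) (IsMonic-toPol h′))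
    where g≈g′×h≈h′ = combine-injective e e′ free free′ (trans (sym f≡gh) f≡g′h′)

  goodsOfShape-unique : ∀ n i k → Unique (goodsOfShape n i k)
  goodsOfShape-unique n i k = Unique-if (a ℕ.* i ℕ.+ b ℕ.* k ℕ.≟ n) λ e →
    Unique-concatMap _ (monics-unique i) (combine-unique e) (disjoint e)
    where
      powerFree : ∀ {h} → h ∈ powerFrees k → IsPowerFreeMonic h
      powerFree h∈ = proj₂ (∈-filter⁻ isPowerFreeMonic? {xs = monics k} h∈)
      combine-unique : a ℕ.* i ℕ.+ b ℕ.* k ≡ n → ∀ g → Unique (combineAll n k g)
      combine-unique e g = Unique-map-injectiveOn (combine n g) (powerFrees-unique k)
        λ h∈ h′∈ eq → toPol-injective _ _ (proj₂ (combine-injective e e (powerFree h∈) (powerFree h′∈) eq))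
      disjoint : a ℕ.* i ℕ.+ b ℕ.* k ≡ n → ∀ {g g′ f} →
                 f ∈ combineAll n k g → f ∈ combineAll n k g′ → g ≡ g′
      disjoint e {g} {g′} f∈ f∈′ with ∈-map⁻ (combine n g) f∈ | ∈-map⁻ (combine n g′) f∈′
      ... | h , h∈ , refl | h′ , h′∈ , eq =
            toPol-injective g g′ (proj₁ (combine-injective e e (powerFree h∈) (powerFree h′∈) eq))

  goods-unique : ∀ n → Unique (goods n)
  goods-unique n = Unique-concatMap _ (Unique.upTo⁺ (suc n)) first-unique
    λ f∈ f∈′ → proj₁ (Shape-unique (proj₂ (∈-goodsOfFirstDegree⁻ f∈)) (proj₂ (∈-goodsOfFirstDegree⁻ f∈′)))
    where
      first-unique : ∀ i → Unique (goodsOfFirstDegree n i)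
      first-unique i = Unique-concatMap _ (Unique.upTo⁺ (suc n)) (goodsOfShape-unique n i)
        λ f∈ f∈′ → proj₂ (Shape-unique (∈-goodsOfShape⁻ f∈) (∈-goodsOfShape⁻ f∈′))

  Good-combine : ∀ {n i k} (g : Monic i) (h : Monic k) → a ℕ.* i ℕ.+ b ℕ.* k ≡ n → Good F a b (combine n g h)
  Good-combine {n} g h e = IsGood⇒Good (combine n g h)
    (IsGood-resp-≈ {(toPol g ^ₚ a) *ₚ (toPol h ^ₚ b)} {toPol (combine n g h)} (≈-sym (toPol-combine g h e))
                   (IsGood-^a*^b (IsMonic-toPol g) (IsMonic-toPol h)))

  Shape⇒Good : ∀ {n i k f} → Shape n i k f → Good F a b f
  Shape⇒Good (shape e g h _ f≡combine) = subst (Good F a b) (sym f≡combine) (Good-combine g h e)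

  ∈-goods⇒Good : ∀ {n f} → f ∈ goods n → Good F a b f
  ∈-goods⇒Good f∈ = Shape⇒Good (proj₂ (proj₂ (∈-goods⁻ f∈)))

  ∈-goods⁺ : ∀ {n i k} (g : Monic i) (h : Monic k) → a ℕ.* i ℕ.+ b ℕ.* k ≡ n → IsPowerFreeMonic h →
             combine n g h ∈ goods n
  ∈-goods⁺ {n} {i} {k} g h e free =
    ∈-concatMap⁺ (goodsOfFirstDegree n) (lose (∈-upTo⁺ (s≤s i≤n)) (∈-concatMap⁺ (goodsOfShape n i) (lose (∈-upTo⁺ (s≤s k≤n))
      (∈-if⁺ (a ℕ.* i ℕ.+ b ℕ.* k ℕ.≟ n) e (∈-concatMap⁺ (combineAll n k) (lose (∈-monics g)
        (∈-map⁺ (combine n g) (∈-filter⁺ isPowerFreeMonic? (∈-monics h) free))))))))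
    where
      i≤n : i ≤ n
      i≤n = ℕ.≤-trans (ℕ.m≤n*m i a {{ℕ.>-nonZero 0<a}}) (ℕ.≤-trans (ℕ.m≤m+n (a ℕ.* i) (b ℕ.* k)) (ℕ.≤-reflexive e))
      k≤n : k ≤ n
      k≤n = ℕ.≤-trans (ℕ.m≤n*m k b {{ℕ.>-nonZero 0<b}}) (ℕ.≤-trans (ℕ.m≤n+m (b ℕ.* k) (a ℕ.* i)) (ℕ.≤-reflexive e))

  Decomposition⇒∈-goods : ∀ {n} (f : Monic n) → Decomposition (toPol f) → f ∈ goods n
  Decomposition⇒∈-goods {n} f (decomposition i k g h g° h° free gᵃhᵇ≈f) =
    subst (_∈ goods n) (sym f≡combine) (∈-goods⁺ (fromPol i g) (fromPol k h) e free′)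
    where
      e : a ℕ.* i ℕ.+ b ℕ.* k ≡ n
      e = monic-degree-unique (HasDegree-resp-≈ gᵃhᵇ≈f (IsMonic-*ₚ (IsMonic-^ₚ g° a) (IsMonic-^ₚ h° b))) (IsMonic-toPol f)
      free′ : IsPowerFreeMonic (fromPol k h)
      free′ = IsPowerFree⇒IsPowerFreeMonic (fromPol k h) (IsPowerFree-resp-≈ (≈-sym (toPol-fromPol k h°)) free)
      f≡combine : f ≡ combine n (fromPol i g) (fromPol k h)
      f≡combine = toPol-injective f _ (≈-sym (≈-trans (toPol-combine (fromPol i g) (fromPol k h) e)
        (≈-trans (*ₚ-cong (^ₚ-congˡ a (toPol-fromPol i g°)) (^ₚ-congˡ b (toPol-fromPol k h°))) gᵃhᵇ≈f)))

  Good⇒∈-goods : ∀ {n} (f : Monic n) → Good F a b f → f ∈ goods n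
  Good⇒∈-goods {n} f good = Decomposition⇒∈-goods f (decompose n (IsMonic-toPol f) (Good⇒IsGood f good))

  length-goodsOfShape : ∀ n i k → length (goodsOfShape n i k) ≡
                        (if ⌊ a ℕ.* i ℕ.+ b ℕ.* k ℕ.≟ n ⌋ then q ^ i ℕ.* powerFreeCount k else 0)
  length-goodsOfShape n i k = trans (length-if (a ℕ.* i ℕ.+ b ℕ.* k ℕ.≟ n))
    (cong (λ t → if ⌊ a ℕ.* i ℕ.+ b ℕ.* k ℕ.≟ n ⌋ then t else 0) (begin
      length (concatMap (combineAll n k) (monics i))
        ≡⟨ length-concatMap _ (monics i) ⟩
      sum (map (λ g → length (map (combine n g) (powerFrees k))) (monics i))
        ≡⟨ cong sum (map-cong (λ g → length-map (combine n g) (powerFrees k)) (monics i)) ⟩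
      sum (map (λ _ → powerFreeCount k) (monics i))
        ≡⟨ sum-map-const (monics i) (powerFreeCount k) ⟩
      length (monics i) ℕ.* powerFreeCount k
        ≡⟨ cong (ℕ._* powerFreeCount k) (length-monics i) ⟩
      q ^ i ℕ.* powerFreeCount k ∎))
    where open ≡-Reasoning

  length-goods : ∀ n → length (goods n) ≡ shapeSum q a b powerFreeCount n
  length-goods n = trans (length-concatMap (goodsOfFirstDegree n) (upTo (suc n))) (cong sum (map-cong length-row (upTo (suc n))))
    where
      length-row : ∀ i → length (goodsOfFirstDegree n i) ≡
                   sum (map (λ k → if ⌊ a ℕ.* i ℕ.+ b ℕ.* k ℕ.≟ n ⌋ then q ^ i ℕ.* powerFreeCount k else 0) (upTo (suc n)))
      length-row i = trans (length-concatMap (goodsOfShape n i) (upTo (suc n)))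
                           (cong sum (map-cong (length-goodsOfShape n i) (upTo (suc n))))

  count : ∀ n {α} → IsCount F a b n α → α ≡ shapeSum q a b powerFreeCount n
  count n (xs , xs! , |xs|≡α , xs≐Good) =
    trans (sym |xs|≡α) (trans (↭-length (∼bag⇒↭ (unique∧set⇒bag xs! (goods-unique n) xs≐goods)))
                              (length-goods n))
    where
      xs≐goods : ∀ {f} → f ∈ xs ⇔ f ∈ goods n
      xs≐goods {f} = mk⇔ (λ f∈xs → Good⇒∈-goods f (Equivalence.to (xs≐Good f) f∈xs))
                         (λ f∈goods → Equivalence.from (xs≐Good f) (∈-goods⇒Good f∈goods))

all-monics-count : ∀ {q} (F : FiniteField q) a (0<a : 0 < a) n →
                   q ^ n ≡ shapeSum q a 1 (PowerFree.powerFreeCount F a 0<a) n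
all-monics-count F a 0<a n =
  trans (sym (length-monics n)) (Counting₁.count n (monics n , monics-unique n , refl , all-good))
  where
    open Enumeration F
    module Counting₁ = Counting F a 1 0<a (s≤s z≤n) (Coprime.sym (Coprime.1-coprimeTo a))
    all-good : ∀ f → f ∈ monics n ⇔ Good F a 1 f
    all-good f = mk⇔ (λ _ → Counting₁.IsGood⇒Good f λ {m = m} _ _ → InM-1 a m) (λ _ → ∈-monics f)

open import Data.Nat using (_+_; _*_)

proposition4p5 : (q : ℕ) → IsPrimePower q → (F : FiniteField q) →
    (a b : ℕ) → 1 ≤ a → 1 ≤ b → Coprime a b → (n α : ℕ) → IsCount F a b n α →
    α + S q a b (a * b) 1 n ≡ S q a b 0 0 n
proposition4p5 q _ F a b 0<a 0<b coprime n α α-counts = begin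
  α + S q a b (a * b) 1 n
    ≡⟨ cong (_+ S q a b (a * b) 1 n) (Counting.count F a b 0<a 0<b coprime n α-counts) ⟩
  shapeSum q a b powerFreeCount n + S q a b (a * b) 1 n
    ≡⟨ shapeSum+shifted≡all q a b 0<b powerFreeCount recurrence n ⟩
  S q a b 0 0 n
    ∎
  where
    open ≡-Reasoning
    open PowerFree F a 0<a using (powerFreeCount)
    recurrence : ∀ k → powerFreeCount k + (if ⌊ a ℕ.≤? k ⌋ then q ℕ.* q ^ (k ℕ.∸ a) else 0) ≡ q ^ k
    recurrence = powerFreeCount-recurrence q a 0<a powerFreeCount (all-monics-count F a 0<a)
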